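{- Let $N, M$ be coprime positive integers, $R$ a ring and $V$ an $R$-module with a left $\mathrm{Mat}_2(\mathbb{Z})_{\neq 0}$-semigroup action. Let $\mathrm{Sh}: H^1(\Gamma_1(N),\mathcal{W}(M,V)) \to H^1(\Gamma_1(NM),V)$ be the Shapiro isomorphism, induced by $\mathcal{W}(M,V)\to V$, $f \mapsto f((0,1))$ (together with restriction to $\Gamma_1(NM)$). Then for all integers $n, d \ge 1$ with $(d,N) = 1$, $$T_n \circ \mathrm{Sh} = \mathrm{Sh}\circ T_n \quad\text{and}\quad \langle d\rangle_N \circ \mathrm{Sh} = \mathrm{Sh} \circ \langle d\rangle_N.$$
   Context: $\mathrm{Mat}_2(\mathbb{Z})_{\neq0}$ is the semigroup of integer $2\times 2$ matrices with nonzero determinant; $\begin{pmatrix}a&b\\c&d\end{pmatrix}^\iota = \begin{pmatrix}d&-b\\-c&a\end{pmatrix}$. $\mathcal{W}(M,V) = \{f \in \mathrm{Hom}_R(R[(\mathbb{Z}/M\mathbb{Z})^2], V) : f((u,v)) = 0$ whenever $\langle u,v\rangle \neq \mathbb{Z}/M\mathbb{Z}\}$, with left action $(g.f)((u,v)) = g.f((u,v)g)$ (row vector times $g$ reduced mod $M$). Hecke operators: for a congruence subgroup $\Gamma$ and a module $W$ with left $\mathrm{Mat}_2(\mathbb{Z})_{\neq0}$-action, and $\alpha$ with $\Gamma\alpha\Gamma = \bigsqcup_{i=1}^n\Gamma\delta_i$, $T_\alpha$ sends a cocycle $c$ to $(T_\alpha c)(g) = \sum_i \delta_i^\iota . c(\delta_i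 g\delta_{j(i)}^{ -1})$ with $j(i)$ such that $\delta_i g \delta_{j(i)}^{ -1}\in\Gamma$. For $\Gamma = \Gamma_1(L)$, $T_n = \sum_\alpha T_\alpha$ over representatives of $\Gamma\backslash\Delta^n/\Gamma$ with $\Delta^n$ the integer matrices of determinant $n$ congruent to $\begin{pmatrix}1&*\\0&*\end{pmatrix}$ mod $L$. On $H^1(\Gamma_1(N),\cdot)$, $\langle d\rangle_N = T_\alpha$ for $\alpha \in \mathrm{SL}_2(\mathbb{Z})$ with $\alpha\equiv\mathrm{diag}(d^{ -1},d)$ mod $N$; on $H^1(\Gamma_1(NM),V)$, $\langle d\rangle_N = T_\alpha$ for $\alpha\in\mathrm{SL}_2(\mathbb{Z})$ with $\alpha \equiv \mathrm{diag}(d^{ -1},d)$ mod $N$ and $\alpha\equiv 1$ mod $M$ (the $N$-part of the diamond operator). $T_n$ on the left is on level $NM$, on the right on level $N$ with coefficients $\mathcal{W}(M,V)$. -}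

module Defs where

open import Level using (Level; _⊔_) renaming (suc to lsuc)
open import Data.Nat as ℕ using (ℕ; NonZero)
open import Data.Nat.DivMod using (_mod_)
open import Data.Integer using (ℤ; +_; _+_; _-_; _*_; -_; _%ℕ_)
open import Data.Integer.Divisibility using (_∣_)
open import Data.Fin using (Fin; toℕ; zero; suc)
open import Data.Product using (Σ; ∃; _×_; _,_; proj₁; proj₂)
open import Relation.Binary.PropositionalEquality using (_≡_)
open import Relation.Nullary using (¬_)
open import Algebra.Bundles using (Ring)
open import Algebra.Module.Bundles using (LeftModule)

record Mat : Set where
  constructor mat
  field
    a b c d : ℤ
open Mat public

_⊙_ : Mat → Mat → Mat
mat a₁ b₁ c₁ d₁ ⊙ mat a₂ b₂ c₂ d₂ =
  mat (a₁ * a₂ + b₁ * c₂) (a₁ * b₂ + b₁ * d₂)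
      (c₁ * a₂ + d₁ * c₂) (c₁ * b₂ + d₁ * d₂)
infixl 7 _⊙_

det : Mat → ℤ
det (mat a b c d) = a * d - b * c

_ι : Mat → Mat
mat a b c d ι = mat d (- b) (- c) a

_≡_[mod_] : ℤ → ℤ → ℕ → Set
x ≡ y [mod K ] = (+ K) ∣ (x - y)

SL2 : Mat → Set
SL2 g = det g ≡ + 1

Γ₁ : ℕ → Mat → Set
Γ₁ L g = SL2 g × (a g ≡ + 1 [mod L ]) × (c g ≡ + 0 [mod L ]) × (d g ≡ + 1 [mod L ])

Δ : ℕ → ℕ → Mat → Set
Δ L n g = det g ≡ + n × (a g ≡ + 1 [mod L ]) × (c g ≡ + 0 [mod L ])

InDouble : (Mat → Set) → Mat → Mat → Set
InDouble Γ α x = Σ Mat λ γ₁ → Σ Mat λ γ₂ → Γ γ₁ × Γ γ₂ × (x ≡ γ₁ ⊙ α ⊙ γ₂)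

InCoset : (Mat → Set) → Mat → Mat → Set
InCoset Γ δ x = Σ Mat λ γ → Γ γ × (x ≡ γ ⊙ δ)

record CosetDecomp (Γ : Mat → Set) (α : Mat) : Set where
  field
    k        : ℕ
    δ        : Fin k → Mat
    δ-in     : ∀ i → InDouble Γ α (δ i)
    covers   : ∀ x → InDouble Γ α x → Σ (Fin k) λ i → InCoset Γ (δ i) x
    disjoint : ∀ i j → InCoset Γ (δ j) (δ i) → i ≡ j
    -- jγ i g = (j(i) , δᵢ g δ_{j(i)}⁻¹)
    jγ       : Fin k → Mat → Fin k × Mat
    jγ-ok    : ∀ i g → Γ g →
               Γ (proj₂ (jγ i g)) × (δ i ⊙ g ≡ proj₂ (jγ i g) ⊙ δ (proj₁ (jγ i g)))

record HeckeData (Γ : Mat → Set) (Δⁿ : Mat → Set) : Set where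
  field
    m        : ℕ
    α        : Fin m → Mat
    α-in     : ∀ k → Δⁿ (α k)
    covers   : ∀ x → Δⁿ x → Σ (Fin m) λ k → InDouble Γ (α k) x
    distinct : ∀ k l → InDouble Γ (α l) (α k) → k ≡ l
    decomp   : (k : Fin m) → CosetDecomp Γ (α k)

sumFin : ∀ {ℓ} {A : Set ℓ} → (A → A → A) → A → ∀ {n} → (Fin n → A) → A
sumFin _⊕_ e {ℕ.zero}  f = e
sumFin _⊕_ e {ℕ.suc n} f = f zero ⊕ sumFin _⊕_ e (λ i → f (suc i))

Tα : ∀ {ℓ} {A : Set ℓ} → (A → A → A) → A → (Mat → A → A) →
     {Γ : Mat → Set} {α : Mat} → CosetDecomp Γ α → (Mat → A) → Mat → A
Tα _⊕_ e act D c g =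
  sumFin _⊕_ e (λ i → act (δ i ι) (c (proj₂ (jγ i g))))
  where open CosetDecomp D

Tn : ∀ {ℓ} {A : Set ℓ} → (A → A → A) → A → (Mat → A → A) →
     {Γ Δⁿ : Mat → Set} → HeckeData Γ Δⁿ → (Mat → A) → Mat → A
Tn _⊕_ e act H c g =
  sumFin _⊕_ e (λ k → Tα _⊕_ e act (decomp k) c g)
  where open HeckeData H

NonzeroDet : Mat → Set
NonzeroDet g = ¬ (det g ≡ + 0)

record MatAction {r ℓr m ℓm} {R : Ring r ℓr} (V : LeftModule R m ℓm)
       : Set (r ⊔ ℓr ⊔ m ⊔ ℓm) where
  open LeftModule V
  open Ring R using () renaming (Carrier to R₀)
  field
    act      : Mat → Carrierᴹ → Carrierᴹ
    act-cong : ∀ g → NonzeroDet g → ∀ {v w} → v ≈ᴹ w → act g v ≈ᴹ act g w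
    act-+    : ∀ g → NonzeroDet g → ∀ v w → act g (v +ᴹ w) ≈ᴹ act g v +ᴹ act g w
    act-*    : ∀ g → NonzeroDet g → ∀ (x : R₀) v → act g (x *ₗ v) ≈ᴹ x *ₗ act g v
    act-∘    : ∀ g h → NonzeroDet g → NonzeroDet h →
               ∀ v → act (g ⊙ h) v ≈ᴹ act g (act h v)

ZM : ℕ → Set
ZM M = Fin M

red : (M : ℕ) .{{_ : NonZero M}} → ℤ → ZM M
red M x = (x %ℕ M) mod M

rowMul : (M : ℕ) .{{_ : NonZero M}} → ZM M × ZM M → Mat → ZM M × ZM M
rowMul M (u , v) g =
  red M ((+ toℕ u) * a g + (+ toℕ v) * c g) ,
  red M ((+ toℕ u) * b g + (+ toℕ v) * d g)

-- ⟨u,v⟩ = ℤ/Mℤ : the subgroup generated by u,v (= {xu + yv}) contains 1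
Generates : (M : ℕ) → ZM M × ZM M → Set
Generates M (u , v) = Σ ℤ λ x → Σ ℤ λ y → (x * (+ toℕ u) + y * (+ toℕ v)) ≡ + 1 [mod M ]

module _ {r ℓr m ℓm} {R : Ring r ℓr} (V : LeftModule R m ℓm) where
  open LeftModule V

  -- Hom_R(R[(ℤ/M)²], V) is identified with functions (ℤ/M)² → V
  -- (R[X] is free on X); 𝒲(M,V) is the submodule of those vanishing on
  -- non-generating pairs.
  WCarrier : ℕ → Set m
  WCarrier M = ZM M × ZM M → Carrierᴹ

  InW : (M : ℕ) → WCarrier M → Set ℓm
  InW M f = ∀ uv → ¬ Generates M uv → f uv ≈ᴹ 0ᴹ

  _+W_ : ∀ {M} → WCarrier M → WCarrier M → WCarrier M
  (f +W g) uv = f uv +ᴹ g uv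

  0W : ∀ {M} → WCarrier M
  0W uv = 0ᴹ

  actW : MatAction V → (M : ℕ) .{{_ : NonZero M}} → Mat → WCarrier M → WCarrier M
  actW A M g f uv = MatAction.act A g (f (rowMul M uv g))

  IsCocycle : MatAction V → (Mat → Set) → (Mat → Carrierᴹ) → Set ℓm
  IsCocycle A Γ c = ∀ g h → Γ g → Γ h →
    c (g ⊙ h) ≈ᴹ c g +ᴹ MatAction.act A g (c h)

  IsWCocycle : MatAction V → (M : ℕ) .{{_ : NonZero M}} → (Mat → Set) →
               (Mat → WCarrier M) → Set ℓm
  IsWCocycle A M Γ c =
    (∀ g → Γ g → InW M (c g)) ×
    (∀ g h → Γ g → Γ h → ∀ uv → c (g ⊙ h) uv ≈ᴹ (c g +W actW A M g (c h)) uv)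

  -- equality in H¹(Γ, V): the cocycles differ by a coboundary g ↦ g.v - v
  Cohomologous : MatAction V → (Mat → Set) → (Mat → Carrierᴹ) → (Mat → Carrierᴹ) →
                 Set (m ⊔ ℓm)
  Cohomologous A Γ c c' = Σ Carrierᴹ λ v → ∀ g → Γ g →
    c g ≈ᴹ c' g +ᴹ (MatAction.act A g v +ᴹ (-ᴹ v))

  -- Shapiro map on cochains: restriction to Γ₁(NM) composed with f ↦ f((0,1))
  Sh : (M : ℕ) .{{_ : NonZero M}} → (Mat → WCarrier M) → Mat → Carrierᴹ
  Sh M c g = c g (red M (+ 0) , red M (+ 1))

  TnV : MatAction V → {Γ Δⁿ : Mat → Set} → HeckeData Γ Δⁿ →
        (Mat → Carrierᴹ) → Mat → Carrierᴹ
  TnV A = Tn _+ᴹ_ 0ᴹ (MatAction.act A)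

  TαV : MatAction V → {Γ : Mat → Set} {α : Mat} → CosetDecomp Γ α →
        (Mat → Carrierᴹ) → Mat → Carrierᴹ
  TαV A = Tα _+ᴹ_ 0ᴹ (MatAction.act A)

  TnW : MatAction V → (M : ℕ) .{{_ : NonZero M}} → {Γ Δⁿ : Mat → Set} →
        HeckeData Γ Δⁿ → (Mat → WCarrier M) → Mat → WCarrier M
  TnW A M = Tn _+W_ 0W (actW A M)

  TαW : MatAction V → (M : ℕ) .{{_ : NonZero M}} → {Γ : Mat → Set} {α : Mat} →
        CosetDecomp Γ α → (Mat → WCarrier M) → Mat → WCarrier M
  TαW A M = Tα _+W_ 0W (actW A M)

DiamondMat : ℕ → ℕ → Mat → Set
DiamondMat N dd α = SL2 α × Σ ℤ λ d' → ((d' * (+ dd)) ≡ (+ 1) [mod N ]) ×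
  (a α ≡ d' [mod N ]) × (b α ≡ + 0 [mod N ]) × (c α ≡ + 0 [mod N ]) × (d α ≡ + dd [mod N ])

DiamondMatNM : ℕ → ℕ → ℕ → Mat → Set
DiamondMatNM N M dd α = DiamondMat N dd α ×
  (a α ≡ + 1 [mod M ]) × (b α ≡ + 0 [mod M ]) × (c α ≡ + 0 [mod M ]) × (d α ≡ + 1 [mod M ])

-- Write Γ = Γ₁(N), Γ′ = Γ₁(NM) and e = (0,1) ∈ (ℤ/M)². A level-N Hecke operator is a sum over
-- right cosets Γ δᵢ, and the corresponding level-NM operator a sum over cosets Γ′ δ′ᵢ′. Each δ′ᵢ′ can be
-- written τᵢ′ δ_φ(i′) with τᵢ′ ∈ Γ, and because Γ acts transitively on the generating pairs of (ℤ/M)²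
-- with Γ′ the stabiliser of e, φ is a bijection onto the cosets Γ δᵢ for which e δᵢ^ι generates; on the
-- other cosets the W(M,V)-valued cocycle c vanishes at e δᵢ^ι. Expanding c(γ′) for γ′ = τᵢ′ γ τⱼ′⁻¹ with
-- the cocycle relation turns each level-NM term into the matching level-N term plus wᵢ′ − g.wⱼ′, where
-- wᵢ′ = δ′ᵢ′^ι . c(τᵢ′)(e); as i′ ↦ j′ permutes the cosets, these corrections add up to the coboundary
-- of −Σ w. Both T_n and the diamond operators ⟨d⟩_N are Hecke operators of this shape.

module Submission where

open import Algebra.Bundles using (AbelianGroup; Ring)
open import Algebra.Module.Bundles using (LeftModule)
open import Data.Nat using (ℕ; NonZero)
open import Data.Nat.Coprimality using (Coprime)
open import Defs using (MatAction)

module Congruence where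

  open import Defs using (_≡_[mod_])
  open import Data.Nat as ℕ using (ℕ; suc; NonZero)
  import Data.Nat.Properties as ℕ
  import Data.Nat.DivMod as ℕ
  open import Data.Nat.Coprimality using (Coprime; coprime-Bézout)
  open import Data.Nat.GCD using (module Bézout)
  open import Data.Integer using (ℤ; +_; -[1+_]; _+_; _-_; _*_; -_)
  import Data.Integer.Properties as ℤ
  import Data.Integer.Divisibility.Signed as Signed
  open import Data.Integer.Tactic.RingSolver using (solve-∀)
  open import Data.Product using (Σ-syntax; _×_; _,_)
  open import Relation.Binary.PropositionalEquality
    using (_≡_; refl; sym; trans; cong; cong₂; subst; module ≡-Reasoning)

  -- x ≡ y [mod K ] with the quotient made explicit: matching on the equation substitutes x away,
  -- after which congruences are combined by the ring solver.
  infix 4 _≋_[mod_]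
  record _≋_[mod_] (x y : ℤ) (K : ℕ) : Set where
    constructor _,_
    field
      quotient : ℤ
      equation : x ≡ y + quotient * + K

  module _ {K : ℕ} where

    ≡mod⇒≋ : ∀ {x y} → x ≡ y [mod K ] → x ≋ y [mod K ]
    ≡mod⇒≋ {x} {y} x≡y with Signed.∣ᵤ⇒∣ x≡y
    ... | Signed.divides q x-y≡qK = q , (begin
      x           ≡⟨ lemma x y ⟩
      y + (x - y) ≡⟨ cong (_+_ y) x-y≡qK ⟩
      y + q * + K ∎)
      where
      open ≡-Reasoning
      lemma : ∀ x y → x ≡ y + (x - y)
      lemma = solve-∀

    ≋⇒≡mod : ∀ {x y} → x ≋ y [mod K ] → x ≡ y [mod K ]
    ≋⇒≡mod {y = y} (q , refl) = Signed.∣⇒∣ᵤ (Signed.divides q (lemma y (q * + K)))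
      where
      lemma : ∀ y z → y + z - y ≡ z
      lemma = solve-∀

    ≋-reflexive : ∀ {x y} → x ≡ y → x ≋ y [mod K ]
    ≋-reflexive {x} refl = + 0 , lemma x (+ K)
      where
      lemma : ∀ x k → x ≡ x + + 0 * k
      lemma = solve-∀

    ≋-refl : ∀ {x} → x ≋ x [mod K ]
    ≋-refl = ≋-reflexive refl

    ≋-sym : ∀ {x y} → x ≋ y [mod K ] → y ≋ x [mod K ]
    ≋-sym {y = y} (q , refl) = - q , lemma y q (+ K)
      where
      lemma : ∀ y q k → y ≡ y + q * k + - q * k
      lemma = solve-∀

    ≋-trans : ∀ {x y z} → x ≋ y [mod K ] → y ≋ z [mod K ] → x ≋ z [mod K ]
    ≋-trans {z = z} (q , refl) (r , refl) = r + q , lemma z q r (+ K)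
      where
      lemma : ∀ z q r k → z + r * k + q * k ≡ z + (r + q) * k
      lemma = solve-∀

    ≋-+ : ∀ {x y u v} → x ≋ y [mod K ] → u ≋ v [mod K ] → x + u ≋ y + v [mod K ]
    ≋-+ {y = y} {v = v} (q , refl) (r , refl) = q + r , lemma y v q r (+ K)
      where
      lemma : ∀ y v q r k → y + q * k + (v + r * k) ≡ y + v + (q + r) * k
      lemma = solve-∀

    ≋-neg : ∀ {x y} → x ≋ y [mod K ] → - x ≋ - y [mod K ]
    ≋-neg {y = y} (q , refl) = - q , lemma y q (+ K)
      where
      lemma : ∀ y q k → - (y + q * k) ≡ - y + - q * k
      lemma = solve-∀

    ≋-* : ∀ {x y u v} → x ≋ y [mod K ] → u ≋ v [mod K ] → x * u ≋ y * v [mod K ]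
    ≋-* {y = y} {v = v} (q , refl) (r , refl) = q * v + y * r + q * r * + K , lemma y v q r (+ K)
      where
      lemma : ∀ y v q r k → (y + q * k) * (v + r * k) ≡ y * v + (q * v + y * r + q * r * k) * k
      lemma = solve-∀

  ≋-weakenˡ : ∀ {K L x y} → x ≋ y [mod K ℕ.* L ] → x ≋ y [mod K ]
  ≋-weakenˡ {K} {L} {y = y} (q , refl) = q * + L , cong (_+_ y) (begin
    q * + (K ℕ.* L)  ≡⟨ cong (q *_) (ℤ.pos-* K L) ⟩
    q * (+ K * + L)  ≡⟨ lemma q (+ K) (+ L) ⟩
    q * + L * + K    ∎)
    where
    open ≡-Reasoning
    lemma : ∀ q k l → q * (k * l) ≡ q * l * k
    lemma = solve-∀

  ≋-weakenʳ : ∀ {K L x y} → x ≋ y [mod K ℕ.* L ] → x ≋ y [mod L ]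
  ≋-weakenʳ {K} {L} {x} {y} = ≋-weakenˡ {L} {K} ∘′ subst (x ≋ y [mod_]) (ℕ.*-comm K L)
    where open import Function using (_∘′_)

  private
    lift-identity : ∀ x y m n → 1 ℕ.+ y ℕ.* n ≡ x ℕ.* m → + x * + m ≡ + 1 + + y * + n
    lift-identity x y m n eq = begin
      + x * + m               ≡⟨ ℤ.pos-* x m ⟨
      + (x ℕ.* m)             ≡⟨ cong +_ eq ⟨
      + (1 ℕ.+ y ℕ.* n)       ≡⟨ ℤ.pos-+ 1 (y ℕ.* n) ⟩
      + 1 + + (y ℕ.* n)       ≡⟨ cong (_+_ (+ 1)) (ℤ.pos-* y n) ⟩
      + 1 + + y * + n         ∎
      where open ≡-Reasoning

  -- Opaque, so that the gcd recursion behind the coefficients never unfolds inside later types.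
  opaque
    bézout : ∀ {m n} → Coprime m n → Σ[ s ∈ ℤ ] Σ[ t ∈ ℤ ] s * + m + t * + n ≡ + 1
    bézout {m} {n} coprime with coprime-Bézout coprime
    ... | Bézout.+- x y eq = + x , - + y , (begin
      + x * + m + - + y * + n             ≡⟨ cong (_+ - + y * + n) (lift-identity x y m n eq) ⟩
      + 1 + + y * + n + - + y * + n       ≡⟨ lemma (+ y) (+ n) ⟩
      + 1                                 ∎)
      where
      open ≡-Reasoning
      lemma : ∀ u v → + 1 + u * v + - u * v ≡ + 1
      lemma = solve-∀
    ... | Bézout.-+ x y eq = - + x , + y , (begin
      - + x * + m + + y * + n             ≡⟨ cong (_+_ (- + x * + m)) (lift-identity y x n m eq) ⟩
      - + x * + m + (+ 1 + + x * + m)     ≡⟨ lemma (+ x) (+ m) ⟩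
      + 1                                 ∎)
      where
      open ≡-Reasoning
      lemma : ∀ u v → - u * v + (+ 1 + u * v) ≡ + 1
      lemma = solve-∀

  ≋-crt : ∀ {N M x y} → Coprime N M →
          x ≋ y [mod N ] → x ≋ y [mod M ] → x ≋ y [mod N ℕ.* M ]
  ≋-crt {N} {M} {x} {y} coprime (q , x≡y+qN) (r , x≡y+rM) with bézout coprime
  ... | s , t , sN+tM≡1 = r * s + q * t , (begin
    x                                            ≡⟨ lemma₁ x y ⟩
    y + (x - y) * + 1                            ≡⟨ cong (λ z → y + (x - y) * z) sN+tM≡1 ⟨
    y + (x - y) * (s * + N + t * + M)            ≡⟨ lemma₂ (x - y) y s t (+ N) (+ M) ⟩
    y + (x - y) * s * + N + (x - y) * t * + M    ≡⟨ cong₂ (λ u v → y + u * s * + N + v * t * + M)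
                                                          (difference x≡y+rM) (difference x≡y+qN) ⟩
    y + r * + M * s * + N + q * + N * t * + M    ≡⟨ lemma₃ y r s q t (+ N) (+ M) ⟩
    y + (r * s + q * t) * (+ N * + M)            ≡⟨ cong (λ z → y + (r * s + q * t) * z) (ℤ.pos-* N M) ⟨
    y + (r * s + q * t) * + (N ℕ.* M)            ∎)
    where
    open ≡-Reasoning
    difference : ∀ {x y z} → x ≡ y + z → x - y ≡ z
    difference {y = y} {z} refl = lemma y z
      where
      lemma : ∀ y z → y + z - y ≡ z
      lemma = solve-∀
    lemma₁ : ∀ x y → x ≡ y + (x - y) * + 1
    lemma₁ = solve-∀
    lemma₂ : ∀ w y s t n m → y + w * (s * n + t * m) ≡ y + w * s * n + w * t * m
    lemma₂ = solve-∀
    lemma₃ : ∀ y r s q t n m → y + r * m * s * n + q * n * t * m ≡ y + (r * s + q * t) * (n * m)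
    lemma₃ = solve-∀

  residues-≡⇒≡ : ∀ {K r₁ r₂ k} .{{_ : NonZero K}} → r₁ ℕ.< K → r₂ ℕ.< K →
                 + r₁ ≡ + r₂ + + k * + K → r₁ ≡ r₂
  residues-≡⇒≡ {K} {r₁} {r₂} {k} r₁<K r₂<K eq = begin
    r₁                    ≡⟨ ℕ.m<n⇒m%n≡m r₁<K ⟨
    r₁ ℕ.% K              ≡⟨ cong (ℕ._% K) r₁≡r₂+kK ⟩
    (r₂ ℕ.+ k ℕ.* K) ℕ.% K ≡⟨ ℕ.[m+kn]%n≡m%n r₂ k K ⟩
    r₂ ℕ.% K              ≡⟨ ℕ.m<n⇒m%n≡m r₂<K ⟩
    r₂                    ∎
    where
    open ≡-Reasoning
    r₁≡r₂+kK : r₁ ≡ r₂ ℕ.+ k ℕ.* K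
    r₁≡r₂+kK = ℤ.+-injective (begin
      + r₁                  ≡⟨ eq ⟩
      + r₂ + + k * + K      ≡⟨ cong (_+_ (+ r₂)) (ℤ.pos-* k K) ⟨
      + r₂ + + (k ℕ.* K)    ≡⟨ ℤ.pos-+ r₂ (k ℕ.* K) ⟨
      + (r₂ ℕ.+ k ℕ.* K)    ∎)

  residues-≋⇒≡ : ∀ {K r₁ r₂} .{{_ : NonZero K}} → r₁ ℕ.< K → r₂ ℕ.< K →
                 + r₁ ≋ + r₂ [mod K ] → r₁ ≡ r₂
  residues-≋⇒≡ r₁<K r₂<K (+ k , eq) = residues-≡⇒≡ {k = k} r₁<K r₂<K eq
  residues-≋⇒≡ {K} {r₁} {r₂} r₁<K r₂<K (-[1+ k ] , eq) = sym (residues-≡⇒≡ {k = suc k} r₂<K r₁<K (begin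
    + r₂                                   ≡⟨ lemma (+ r₂) (+ suc k) (+ K) ⟩
    + r₂ + -[1+ k ] * + K + + suc k * + K  ≡⟨ cong (_+ + suc k * + K) eq ⟨
    + r₁ + + suc k * + K                   ∎))
    where
    open ≡-Reasoning
    lemma : ∀ r n k → r ≡ r + - n * k + n * k
    lemma = solve-∀

  opaque
    chinese-remainder : ∀ {N M} → Coprime N M → ∀ x y →
                        Σ[ z ∈ ℤ ] z ≋ x [mod N ] × z ≋ y [mod M ]
    chinese-remainder {N} {M} coprime x y with bézout coprime
    ... | s , t , sN+tM≡1 = x * (t * + M) + y * (s * + N) ,
      ((y - x) * s , (begin
        x * (t * + M) + y * (s * + N)       ≡⟨ cong (λ w → x * w + y * (s * + N)) tM≡1-sN ⟩
        x * (+ 1 - s * + N) + y * (s * + N) ≡⟨ lemma x y s (+ N) ⟩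
        x + (y - x) * s * + N               ∎)) ,
      ((x - y) * t , (begin
        x * (t * + M) + y * (s * + N)       ≡⟨ cong (λ w → x * (t * + M) + y * w) sN≡1-tM ⟩
        x * (t * + M) + y * (+ 1 - t * + M) ≡⟨ lemma′ x y t (+ M) ⟩
        y + (x - y) * t * + M               ∎))
      where
      open ≡-Reasoning
      solve-for : ∀ u v → u + v ≡ + 1 → v ≡ + 1 - u
      solve-for u v u+v≡1 = trans (lemma″ u v) (cong (_- u) u+v≡1)
        where
        lemma″ : ∀ u v → v ≡ u + v - u
        lemma″ = solve-∀
      tM≡1-sN : t * + M ≡ + 1 - s * + N
      tM≡1-sN = solve-for (s * + N) (t * + M) sN+tM≡1
      sN≡1-tM : s * + N ≡ + 1 - t * + M
      sN≡1-tM = solve-for (t * + M) (s * + N) (trans (ℤ.+-comm (t * + M) (s * + N)) sN+tM≡1)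
      lemma : ∀ x y s n → x * (+ 1 - s * n) + y * (s * n) ≡ x + (y - x) * s * n
      lemma = solve-∀
      lemma′ : ∀ x y t m → x * (t * m) + y * (+ 1 - t * m) ≡ y + (x - y) * t * m
      lemma′ = solve-∀

module Matrix where

  open import Defs using (Mat; mat; a; b; c; d; _⊙_; det; _ι; SL2; NonzeroDet)
  open import Level using (0ℓ)
  open import Algebra.Bundles using (Monoid)
  open import Data.Integer using (ℤ; +_; _+_; _-_; _*_; -_; ≢-nonZero)
  import Data.Integer.Properties as ℤ
  open import Data.Integer.Tactic.RingSolver using (solve-∀)
  open import Data.Product using (_,_)
  open import Data.Sum using ([_,_])
  open import Function using (_∘_)
  open import Relation.Binary.PropositionalEquality
    using (_≡_; refl; sym; trans; cong; cong₂; isEquivalence; module ≡-Reasoning)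

  mat-cong : ∀ {a b c d a′ b′ c′ d′} → a ≡ a′ → b ≡ b′ → c ≡ c′ → d ≡ d′ →
             mat a b c d ≡ mat a′ b′ c′ d′
  mat-cong refl refl refl refl = refl

  I₂ : Mat
  I₂ = mat (+ 1) (+ 0) (+ 0) (+ 1)

  scalar : ℤ → Mat
  scalar t = mat t (+ 0) (+ 0) t

  ⊙-assoc : ∀ g h k → g ⊙ h ⊙ k ≡ g ⊙ (h ⊙ k)
  ⊙-assoc (mat a₁ b₁ c₁ d₁) (mat a₂ b₂ c₂ d₂) (mat a₃ b₃ c₃ d₃) =
    mat-cong (lemma a₁ b₁ a₂ b₂ c₂ d₂ a₃ c₃) (lemma a₁ b₁ a₂ b₂ c₂ d₂ b₃ d₃)
             (lemma c₁ d₁ a₂ b₂ c₂ d₂ a₃ c₃) (lemma c₁ d₁ a₂ b₂ c₂ d₂ b₃ d₃)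
    where
    lemma : ∀ x y a b c d p q → (x * a + y * c) * p + (x * b + y * d) * q ≡
                                x * (a * p + b * q) + y * (c * p + d * q)
    lemma = solve-∀

  ⊙-identityˡ : ∀ g → I₂ ⊙ g ≡ g
  ⊙-identityˡ (mat a b c d) = mat-cong (lemma a c) (lemma b d) (lemma′ a c) (lemma′ b d)
    where
    lemma : ∀ x y → + 1 * x + + 0 * y ≡ x
    lemma = solve-∀
    lemma′ : ∀ x y → + 0 * x + + 1 * y ≡ y
    lemma′ = solve-∀

  ⊙-identityʳ : ∀ g → g ⊙ I₂ ≡ g
  ⊙-identityʳ (mat a b c d) = mat-cong (lemma a b) (lemma′ a b) (lemma c d) (lemma′ c d)
    where
    lemma : ∀ x y → x * + 1 + y * + 0 ≡ x
    lemma = solve-∀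
    lemma′ : ∀ x y → x * + 0 + y * + 1 ≡ y
    lemma′ = solve-∀

  ⊙-monoid : Monoid 0ℓ 0ℓ
  ⊙-monoid = record
    { Carrier = Mat
    ; _≈_ = _≡_
    ; _∙_ = _⊙_
    ; ε = I₂
    ; isMonoid = record
      { isSemigroup = record
        { isMagma = record { isEquivalence = isEquivalence ; ∙-cong = cong₂ _⊙_ }
        ; assoc = ⊙-assoc
        }
      ; identity = ⊙-identityˡ , ⊙-identityʳ
      }
    }

  det-⊙ : ∀ g h → det (g ⊙ h) ≡ det g * det h
  det-⊙ (mat a₁ b₁ c₁ d₁) (mat a₂ b₂ c₂ d₂) = lemma a₁ b₁ c₁ d₁ a₂ b₂ c₂ d₂
    where
    lemma : ∀ a₁ b₁ c₁ d₁ a₂ b₂ c₂ d₂ →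
            (a₁ * a₂ + b₁ * c₂) * (c₁ * b₂ + d₁ * d₂) - (a₁ * b₂ + b₁ * d₂) * (c₁ * a₂ + d₁ * c₂) ≡
            (a₁ * d₁ - b₁ * c₁) * (a₂ * d₂ - b₂ * c₂)
    lemma = solve-∀

  det-ι : ∀ g → det (g ι) ≡ det g
  det-ι (mat a b c d) = lemma a b c d
    where
    lemma : ∀ a b c d → d * a - - b * - c ≡ a * d - b * c
    lemma = solve-∀

  ι-anti-⊙ : ∀ g h → (g ⊙ h) ι ≡ h ι ⊙ g ι
  ι-anti-⊙ (mat a₁ b₁ c₁ d₁) (mat a₂ b₂ c₂ d₂) = mat-cong
    (lemma-a c₁ d₁ b₂ d₂) (lemma-b a₁ b₁ b₂ d₂) (lemma-c c₁ d₁ a₂ c₂) (lemma-d a₁ b₁ a₂ c₂)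
    where
    lemma-a : ∀ x y p q → x * p + y * q ≡ q * y + - p * - x
    lemma-a = solve-∀
    lemma-b : ∀ x y p q → - (x * p + y * q) ≡ q * - y + - p * x
    lemma-b = solve-∀
    lemma-c : ∀ x y p q → - (x * p + y * q) ≡ - q * y + p * - x
    lemma-c = solve-∀
    lemma-d : ∀ x y p q → x * p + y * q ≡ - q * - y + p * x
    lemma-d = solve-∀

  ι⊙-det : ∀ g → g ι ⊙ g ≡ scalar (det g)
  ι⊙-det (mat a b c d) = mat-cong (lemma a b c d) (lemma′ b d) (lemma‴ c a) (lemma″ a b c d)
    where
    lemma : ∀ a b c d → d * a + - b * c ≡ a * d - b * c
    lemma = solve-∀
    lemma′ : ∀ x y → y * x + - x * y ≡ + 0
    lemma′ = solve-∀
    lemma‴ : ∀ x y → - x * y + y * x ≡ + 0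
    lemma‴ = solve-∀
    lemma″ : ∀ a b c d → - c * b + a * d ≡ a * d - b * c
    lemma″ = solve-∀

  ⊙ι-det : ∀ g → g ⊙ g ι ≡ scalar (det g)
  ⊙ι-det (mat a b c d) = mat-cong (lemma a b c d) (lemma′ a b) (lemma‴ c d) (lemma″ a b c d)
    where
    lemma : ∀ a b c d → a * d + b * - c ≡ a * d - b * c
    lemma = solve-∀
    lemma′ : ∀ x y → x * - y + y * x ≡ + 0
    lemma′ = solve-∀
    lemma‴ : ∀ x y → x * y + y * - x ≡ + 0
    lemma‴ = solve-∀
    lemma″ : ∀ a b c d → c * - b + d * a ≡ a * d - b * c
    lemma″ = solve-∀

  ⊙-scalar : ∀ t g → g ⊙ scalar t ≡ mat (a g * t) (b g * t) (c g * t) (d g * t)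
  ⊙-scalar t (mat a b c d) = mat-cong (lemma a b t) (lemma′ a b t) (lemma c d t) (lemma′ c d t)
    where
    lemma : ∀ x y t → x * t + y * + 0 ≡ x * t
    lemma = solve-∀
    lemma′ : ∀ x y t → x * + 0 + y * t ≡ y * t
    lemma′ = solve-∀

  scalar-comm : ∀ t g → scalar t ⊙ g ≡ g ⊙ scalar t
  scalar-comm t (mat a b c d) = mat-cong (lemma-a t a b c) (lemma-b t a b d) (lemma-c t a c d) (lemma-d t b c d)
    where
    lemma-a : ∀ t a b c → t * a + + 0 * c ≡ a * t + b * + 0
    lemma-a = solve-∀
    lemma-b : ∀ t a b d → t * b + + 0 * d ≡ a * + 0 + b * t
    lemma-b = solve-∀
    lemma-c : ∀ t a c d → + 0 * a + t * c ≡ c * t + d * + 0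
    lemma-c = solve-∀
    lemma-d : ∀ t b c d → + 0 * b + t * d ≡ c * + 0 + d * t
    lemma-d = solve-∀

  ⊙-cancelʳ : ∀ {g h} δ → NonzeroDet δ → g ⊙ δ ≡ h ⊙ δ → g ≡ h
  ⊙-cancelʳ {g} {h} δ det≢0 gδ≡hδ = mat-cong (cancel (cong a gt≡ht)) (cancel (cong b gt≡ht))
                                              (cancel (cong c gt≡ht)) (cancel (cong d gt≡ht))
    where
    open ≡-Reasoning
    t : ℤ
    t = det δ
    gt≡ht : mat (a g * t) (b g * t) (c g * t) (d g * t) ≡ mat (a h * t) (b h * t) (c h * t) (d h * t)
    gt≡ht = begin
      mat (a g * t) (b g * t) (c g * t) (d g * t) ≡⟨ ⊙-scalar t g ⟨
      g ⊙ scalar t                                ≡⟨ cong (g ⊙_) (⊙ι-det δ) ⟨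
      g ⊙ (δ ⊙ δ ι)                               ≡⟨ ⊙-assoc g δ (δ ι) ⟨
      g ⊙ δ ⊙ δ ι                                 ≡⟨ cong (_⊙ δ ι) gδ≡hδ ⟩
      h ⊙ δ ⊙ δ ι                                 ≡⟨ ⊙-assoc h δ (δ ι) ⟩
      h ⊙ (δ ⊙ δ ι)                               ≡⟨ cong (h ⊙_) (⊙ι-det δ) ⟩
      h ⊙ scalar t                                ≡⟨ ⊙-scalar t h ⟩
      mat (a h * t) (b h * t) (c h * t) (d h * t) ∎
    cancel : ∀ {x y} → x * t ≡ y * t → x ≡ y
    cancel {x} {y} = ℤ.*-cancelʳ-≡ x y t {{≢-nonZero det≢0}}

  ι-inverseˡ : ∀ g → SL2 g → g ι ⊙ g ≡ I₂
  ι-inverseˡ g det≡1 = trans (ι⊙-det g) (cong scalar det≡1)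

  ι-inverseʳ : ∀ g → SL2 g → g ⊙ g ι ≡ I₂
  ι-inverseʳ g det≡1 = trans (⊙ι-det g) (cong scalar det≡1)

  SL2-I₂ : SL2 I₂
  SL2-I₂ = refl

  SL2-⊙ : ∀ g h → SL2 g → SL2 h → SL2 (g ⊙ h)
  SL2-⊙ g h det-g≡1 det-h≡1 = trans (det-⊙ g h) (cong₂ _*_ det-g≡1 det-h≡1)

  SL2-ι : ∀ g → SL2 g → SL2 (g ι)
  SL2-ι g = trans (det-ι g)

  SL2⇒NonzeroDet : ∀ g → SL2 g → NonzeroDet g
  SL2⇒NonzeroDet g det≡1 det≡0 with trans (sym det≡1) det≡0
  ... | ()

  NonzeroDet-ι : ∀ g → NonzeroDet g → NonzeroDet (g ι)
  NonzeroDet-ι g det≢0 = det≢0 ∘ trans (sym (det-ι g))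

  NonzeroDet-⊙ : ∀ g h → NonzeroDet g → NonzeroDet h → NonzeroDet (g ⊙ h)
  NonzeroDet-⊙ g h det-g≢0 det-h≢0 =
    [ det-g≢0 , det-h≢0 ] ∘ ℤ.i*j≡0⇒i≡0∨j≡0 (det g) ∘ trans (sym (det-⊙ g h))

  SL2-moveˡ : ∀ γ {x y} → SL2 γ → x ≡ γ ⊙ y → γ ι ⊙ x ≡ y
  SL2-moveˡ γ {y = y} det≡1 refl = begin
    γ ι ⊙ (γ ⊙ y)  ≡⟨ ⊙-assoc (γ ι) γ y ⟨
    γ ι ⊙ γ ⊙ y    ≡⟨ cong (_⊙ y) (ι-inverseˡ γ det≡1) ⟩
    I₂ ⊙ y         ≡⟨ ⊙-identityˡ y ⟩
    y              ∎
    where open ≡-Reasoning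

  SL2-moveʳ : ∀ γ {x y} → SL2 γ → x ≡ y ⊙ γ → x ⊙ γ ι ≡ y
  SL2-moveʳ γ {y = y} det≡1 refl = begin
    y ⊙ γ ⊙ γ ι    ≡⟨ ⊙-assoc y γ (γ ι) ⟩
    y ⊙ (γ ⊙ γ ι)  ≡⟨ cong (y ⊙_) (ι-inverseʳ γ det≡1) ⟩
    y ⊙ I₂         ≡⟨ ⊙-identityʳ y ⟩
    y              ∎
    where open ≡-Reasoning

  -- ι is the adjugate: it reverses products and δ ι ⊙ δ is the scalar det δ.
  ι-swap : ∀ δ δ′ g γ → det δ ≡ det δ′ → NonzeroDet δ′ → δ ⊙ g ≡ γ ⊙ δ′ → δ ι ⊙ γ ≡ g ⊙ δ′ ι
  ι-swap δ δ′ g γ det≡det′ det′≢0 δg≡γδ′ = ⊙-cancelʳ δ′ det′≢0 (begin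
    δ ι ⊙ γ ⊙ δ′          ≡⟨ ⊙-assoc (δ ι) γ δ′ ⟩
    δ ι ⊙ (γ ⊙ δ′)        ≡⟨ cong (δ ι ⊙_) δg≡γδ′ ⟨
    δ ι ⊙ (δ ⊙ g)         ≡⟨ ⊙-assoc (δ ι) δ g ⟨
    δ ι ⊙ δ ⊙ g           ≡⟨ cong (_⊙ g) (trans (ι⊙-det δ) (cong scalar det≡det′)) ⟩
    scalar (det δ′) ⊙ g   ≡⟨ scalar-comm (det δ′) g ⟩
    g ⊙ scalar (det δ′)   ≡⟨ cong (g ⊙_) (ι⊙-det δ′) ⟨
    g ⊙ (δ′ ι ⊙ δ′)       ≡⟨ ⊙-assoc g (δ′ ι) δ′ ⟨
    g ⊙ δ′ ι ⊙ δ′         ∎)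
    where open ≡-Reasoning

  ι-cancelʳ : ∀ x γ → SL2 γ → x ⊙ γ ι ⊙ γ ≡ x
  ι-cancelʳ x γ det≡1 = trans (⊙-assoc x (γ ι) γ) (trans (cong (x ⊙_) (ι-inverseˡ γ det≡1)) (⊙-identityʳ x))

  ⊙-assoc₄ : ∀ a b c d → a ⊙ (b ⊙ (c ⊙ d)) ≡ a ⊙ b ⊙ c ⊙ d
  ⊙-assoc₄ a b c d = trans (sym (⊙-assoc a b (c ⊙ d))) (sym (⊙-assoc (a ⊙ b) c d))

module CongruenceSubgroup where

  open import Defs using (Mat; a; b; c; d; _⊙_; det; _ι; SL2; Γ₁; Δ; InDouble; InCoset)
  open Congruence
  open Matrix
  open import Data.Nat as ℕ using (ℕ)
  open import Data.Nat.Coprimality using (Coprime)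
  open import Data.Integer using (ℤ; +_; _+_; _-_; _*_; -_)
  import Data.Integer.Properties as ℤ
  open import Data.Integer.Tactic.RingSolver using (solve-∀)
  open import Data.Product using (Σ-syntax; _×_; _,_)
  open import Relation.Binary.PropositionalEquality using (_≡_; refl; sym; trans; cong; cong₂; module ≡-Reasoning)

  record FirstColumn (L : ℕ) (p : ℤ) (g : Mat) : Set where
    constructor firstColumn
    field
      a≋ : a g ≋ p [mod L ]
      c≋0 : c g ≋ + 0 [mod L ]

  record UpperTriangular (L : ℕ) (p q : ℤ) (g : Mat) : Set where
    constructor upperTriangular
    field
      column : FirstColumn L p g
      d≋ : d g ≋ q [mod L ]

  FirstColumn-⊙ : ∀ {L p p′ g h} → FirstColumn L p g → FirstColumn L p′ h → FirstColumn L (p * p′) (g ⊙ h)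
  FirstColumn-⊙ {p = p} {p′} {g} {h} (firstColumn a≋p c≋0) (firstColumn a′≋p′ c′≋0) = firstColumn
    (≋-trans (≋-+ (≋-* a≋p a′≋p′) (≋-* (≋-refl {x = b g}) c′≋0)) (≋-reflexive (lemma p p′ (b g))))
    (≋-trans (≋-+ (≋-* c≋0 (≋-refl {x = a h})) (≋-* (≋-refl {x = d g}) c′≋0)) (≋-reflexive (lemma′ (a h) (d g))))
    where
    lemma : ∀ p p′ b → p * p′ + b * + 0 ≡ p * p′
    lemma = solve-∀
    lemma′ : ∀ a d → + 0 * a + d * + 0 ≡ + 0
    lemma′ = solve-∀

  UpperTriangular-⊙ : ∀ {L p q p′ q′ g h} → UpperTriangular L p q g → UpperTriangular L p′ q′ h →
                      UpperTriangular L (p * p′) (q * q′) (g ⊙ h)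
  UpperTriangular-⊙ {q = q} {q′ = q′} {g} {h} (upperTriangular col d≋q) (upperTriangular col′ d′≋q′) =
    upperTriangular (FirstColumn-⊙ col col′)
      (≋-trans (≋-+ (≋-* (FirstColumn.c≋0 col) (≋-refl {x = b h})) (≋-* d≋q d′≋q′))
               (≋-reflexive (lemma (b h) q q′)))
    where
    lemma : ∀ b q q′ → + 0 * b + q * q′ ≡ q * q′
    lemma = solve-∀

  UpperTriangular-ι : ∀ {L p q g} → UpperTriangular L p q g → UpperTriangular L q p (g ι)
  UpperTriangular-ι (upperTriangular (firstColumn a≋p c≋0) d≋q) =
    upperTriangular (firstColumn d≋q (≋-neg c≋0)) a≋p

  UpperTriangular-I₂ : ∀ {L} → UpperTriangular L (+ 1) (+ 1) I₂
  UpperTriangular-I₂ = upperTriangular (firstColumn ≋-refl ≋-refl) ≋-refl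

  UpperTriangular-convert : ∀ {L p q p′ q′ g} → p ≋ p′ [mod L ] → q ≋ q′ [mod L ] →
                            UpperTriangular L p q g → UpperTriangular L p′ q′ g
  UpperTriangular-convert p≋p′ q≋q′ (upperTriangular (firstColumn a≋p c≋0) d≋q) =
    upperTriangular (firstColumn (≋-trans a≋p p≋p′) c≋0) (≋-trans d≋q q≋q′)

  UpperTriangular-⊙ι : ∀ {L p p′ q g h} → UpperTriangular L p q g → UpperTriangular L p′ q h →
                       p * q ≋ + 1 [mod L ] → p′ * q ≋ + 1 [mod L ] → UpperTriangular L (+ 1) (+ 1) (g ⊙ h ι)
  UpperTriangular-⊙ι {p′ = p′} {q} g-upper h-upper pq≋1 p′q≋1 =
    UpperTriangular-convert pq≋1 (≋-trans (≋-reflexive (ℤ.*-comm q p′)) p′q≋1)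
      (UpperTriangular-⊙ g-upper (UpperTriangular-ι h-upper))

  SL2⇒ad≋1 : ∀ {L} g → SL2 g → c g ≋ + 0 [mod L ] → a g * d g ≋ + 1 [mod L ]
  SL2⇒ad≋1 g det≡1 c≋0 = ≋-trans (≋-reflexive (lemma (a g) (b g) (c g) (d g)))
    (≋-trans (≋-+ (≋-reflexive det≡1) (≋-* (≋-refl {x = b g}) c≋0)) (≋-reflexive (lemma′ (b g))))
    where
    lemma : ∀ a b c d → a * d ≡ a * d - b * c + b * c
    lemma = solve-∀
    lemma′ : ∀ b → + 1 + b * + 0 ≡ + 1
    lemma′ = solve-∀

  SL2-a≋1⇒d≋1 : ∀ {L} g → SL2 g → c g ≋ + 0 [mod L ] → a g ≋ + 1 [mod L ] → d g ≋ + 1 [mod L ]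
  SL2-a≋1⇒d≋1 g det≡1 c≋0 a≋1 =
    ≋-trans (≋-reflexive (sym (ℤ.*-identityˡ (d g))))
            (≋-trans (≋-* (≋-sym a≋1) (≋-refl {x = d g})) (SL2⇒ad≋1 g det≡1 c≋0))

  SL2-d≋1⇒a≋1 : ∀ {L} g → SL2 g → c g ≋ + 0 [mod L ] → d g ≋ + 1 [mod L ] → a g ≋ + 1 [mod L ]
  SL2-d≋1⇒a≋1 g det≡1 c≋0 d≋1 =
    ≋-trans (≋-reflexive (sym (ℤ.*-identityʳ (a g))))
            (≋-trans (≋-* (≋-refl {x = a g}) (≋-sym d≋1)) (SL2⇒ad≋1 g det≡1 c≋0))

  module _ {K L : ℕ} where

    FirstColumn-weakenˡ : ∀ {p g} → FirstColumn (K ℕ.* L) p g → FirstColumn K p g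
    FirstColumn-weakenˡ (firstColumn a≋p c≋0) = firstColumn (≋-weakenˡ a≋p) (≋-weakenˡ c≋0)

    FirstColumn-weakenʳ : ∀ {p g} → FirstColumn (K ℕ.* L) p g → FirstColumn L p g
    FirstColumn-weakenʳ (firstColumn a≋p c≋0) = firstColumn (≋-weakenʳ {K} a≋p) (≋-weakenʳ {K} c≋0)

    FirstColumn-crt : ∀ {p g} → Coprime K L → FirstColumn K p g → FirstColumn L p g → FirstColumn (K ℕ.* L) p g
    FirstColumn-crt coprime (firstColumn a≋p c≋0) (firstColumn a≋p′ c≋0′) =
      firstColumn (≋-crt coprime a≋p a≋p′) (≋-crt coprime c≋0 c≋0′)

    UpperTriangular-weakenˡ : ∀ {p q g} → UpperTriangular (K ℕ.* L) p q g → UpperTriangular K p q g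
    UpperTriangular-weakenˡ (upperTriangular col d≋q) = upperTriangular (FirstColumn-weakenˡ col) (≋-weakenˡ d≋q)

    UpperTriangular-weakenʳ : ∀ {p q g} → UpperTriangular (K ℕ.* L) p q g → UpperTriangular L p q g
    UpperTriangular-weakenʳ (upperTriangular col d≋q) = upperTriangular (FirstColumn-weakenʳ col) (≋-weakenʳ {K} d≋q)

    UpperTriangular-crt : ∀ {p q g} → Coprime K L → UpperTriangular K p q g → UpperTriangular L p q g →
                          UpperTriangular (K ℕ.* L) p q g
    UpperTriangular-crt coprime (upperTriangular col d≋q) (upperTriangular col′ d≋q′) =
      upperTriangular (FirstColumn-crt coprime col col′) (≋-crt coprime d≋q d≋q′)

  -- Membership in Γ₁(L) as a record indexed by g: unlike the Σ-type Γ₁ L g, whose components are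
  -- computed from the entries of g, its type determines g, so g can be left implicit.
  record InΓ₁ (L : ℕ) (g : Mat) : Set where
    constructor inΓ₁
    field
      sl2 : SL2 g
      upper : UpperTriangular L (+ 1) (+ 1) g

  open InΓ₁ public

  Γ₁⇒InΓ₁ : ∀ {L g} → Γ₁ L g → InΓ₁ L g
  Γ₁⇒InΓ₁ (det≡1 , a≡1 , c≡0 , d≡1) = inΓ₁ det≡1 (upperTriangular (firstColumn (≡mod⇒≋ a≡1) (≡mod⇒≋ c≡0)) (≡mod⇒≋ d≡1))

  InΓ₁⇒Γ₁ : ∀ {L g} → InΓ₁ L g → Γ₁ L g
  InΓ₁⇒Γ₁ (inΓ₁ det≡1 (upperTriangular (firstColumn a≋1 c≋0) d≋1)) = det≡1 , ≋⇒≡mod a≋1 , ≋⇒≡mod c≋0 , ≋⇒≡mod d≋1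

  InΓ₁-⊙ : ∀ {L g h} → InΓ₁ L g → InΓ₁ L h → InΓ₁ L (g ⊙ h)
  InΓ₁-⊙ {g = g} {h} (inΓ₁ g-sl2 g-upper) (inΓ₁ h-sl2 h-upper) =
    inΓ₁ (SL2-⊙ g h g-sl2 h-sl2) (UpperTriangular-⊙ g-upper h-upper)

  InΓ₁-ι : ∀ {L g} → InΓ₁ L g → InΓ₁ L (g ι)
  InΓ₁-ι {g = g} (inΓ₁ g-sl2 g-upper) = inΓ₁ (SL2-ι g g-sl2) (UpperTriangular-ι g-upper)

  InΓ₁-I₂ : ∀ {L} → InΓ₁ L I₂
  InΓ₁-I₂ = inΓ₁ SL2-I₂ UpperTriangular-I₂

  InΓ₁-weakenˡ : ∀ {N M g} → InΓ₁ (N ℕ.* M) g → InΓ₁ N g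
  InΓ₁-weakenˡ (inΓ₁ g-sl2 g-upper) = inΓ₁ g-sl2 (UpperTriangular-weakenˡ g-upper)

  InΓ₁-weakenʳ : ∀ {N M g} → InΓ₁ (N ℕ.* M) g → InΓ₁ M g
  InΓ₁-weakenʳ {N} (inΓ₁ g-sl2 g-upper) = inΓ₁ g-sl2 (UpperTriangular-weakenʳ {N} g-upper)

  InΓ₁-crt : ∀ {N M g} → Coprime N M → InΓ₁ N g → UpperTriangular M (+ 1) (+ 1) g → InΓ₁ (N ℕ.* M) g
  InΓ₁-crt coprime (inΓ₁ g-sl2 g-upper) g-upperᴹ = inΓ₁ g-sl2 (UpperTriangular-crt coprime g-upper g-upperᴹ)

  InΓ₁-crt-column : ∀ {N M σ} → Coprime N M → InΓ₁ N σ → FirstColumn M (+ 1) σ → InΓ₁ (N ℕ.* M) σ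
  InΓ₁-crt-column {σ = σ} coprime σ∈Γ col@(firstColumn a≋1 c≋0) =
    InΓ₁-crt coprime σ∈Γ (upperTriangular col (SL2-a≋1⇒d≋1 σ (sl2 σ∈Γ) c≋0 a≋1))

  record InΔ (L n : ℕ) (g : Mat) : Set where
    constructor inΔ
    field
      det≡n : det g ≡ + n
      column : FirstColumn L (+ 1) g

  Δ⇒InΔ : ∀ {L n g} → Δ L n g → InΔ L n g
  Δ⇒InΔ (det≡n , a≡1 , c≡0) = inΔ det≡n (firstColumn (≡mod⇒≋ a≡1) (≡mod⇒≋ c≡0))

  InΔ⇒Δ : ∀ {L n g} → InΔ L n g → Δ L n g
  InΔ⇒Δ (inΔ det≡n (firstColumn a≋1 c≋0)) = det≡n , ≋⇒≡mod a≋1 , ≋⇒≡mod c≋0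

  InΓ₁-⊙-InΔ : ∀ {L n γ δ} → InΓ₁ L γ → InΔ L n δ → InΔ L n (γ ⊙ δ)
  InΓ₁-⊙-InΔ {n = n} {γ} {δ} (inΓ₁ γ-sl2 γ-upper) (inΔ det≡n col) =
    inΔ (trans (det-⊙ γ δ) (trans (cong₂ _*_ γ-sl2 det≡n) (ℤ.*-identityˡ (+ n))))
        (FirstColumn-⊙ (UpperTriangular.column γ-upper) col)

  InΔ-⊙-InΓ₁ : ∀ {L n δ γ} → InΔ L n δ → InΓ₁ L γ → InΔ L n (δ ⊙ γ)
  InΔ-⊙-InΓ₁ {n = n} {δ} {γ} (inΔ det≡n col) (inΓ₁ γ-sl2 γ-upper) =
    inΔ (trans (det-⊙ δ γ) (trans (cong₂ _*_ det≡n γ-sl2) (ℤ.*-identityʳ (+ n))))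
        (FirstColumn-⊙ col (UpperTriangular.column γ-upper))

  InΔ-weakenˡ : ∀ {N M n g} → InΔ (N ℕ.* M) n g → InΔ N n g
  InΔ-weakenˡ (inΔ det≡n col) = inΔ det≡n (FirstColumn-weakenˡ col)

  InΔ-crt : ∀ {N M n g} → Coprime N M → InΔ N n g → FirstColumn M (+ 1) g → InΔ (N ℕ.* M) n g
  InΔ-crt coprime (inΔ det≡n col) colᴹ = inΔ det≡n (FirstColumn-crt coprime col colᴹ)

  Coset : ℕ → Mat → Mat → Set
  Coset L y x = Σ[ γ ∈ Mat ] InΓ₁ L γ × x ≡ γ ⊙ y

  Double : ℕ → Mat → Mat → Set
  Double L α x = Σ[ γ₁ ∈ Mat ] Σ[ γ₂ ∈ Mat ] InΓ₁ L γ₁ × InΓ₁ L γ₂ × x ≡ γ₁ ⊙ α ⊙ γ₂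

  module _ {L : ℕ} where

    InDouble⇒Double : ∀ {α x} → InDouble (Γ₁ L) α x → Double L α x
    InDouble⇒Double (γ₁ , γ₂ , γ₁∈Γ , γ₂∈Γ , x≡γ₁αγ₂) = γ₁ , γ₂ , Γ₁⇒InΓ₁ γ₁∈Γ , Γ₁⇒InΓ₁ γ₂∈Γ , x≡γ₁αγ₂

    Double⇒InDouble : ∀ {α x} → Double L α x → InDouble (Γ₁ L) α x
    Double⇒InDouble (γ₁ , γ₂ , γ₁∈Γ , γ₂∈Γ , x≡γ₁αγ₂) = γ₁ , γ₂ , InΓ₁⇒Γ₁ γ₁∈Γ , InΓ₁⇒Γ₁ γ₂∈Γ , x≡γ₁αγ₂

    InCoset⇒Coset : ∀ {y x} → InCoset (Γ₁ L) y x → Coset L y x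
    InCoset⇒Coset (γ , γ∈Γ , x≡γy) = γ , Γ₁⇒InΓ₁ γ∈Γ , x≡γy

    Coset⇒InCoset : ∀ {y x} → Coset L y x → InCoset (Γ₁ L) y x
    Coset⇒InCoset (γ , γ∈Γ , x≡γy) = γ , InΓ₁⇒Γ₁ γ∈Γ , x≡γy

    Coset⇒Double : ∀ {y x} → Coset L y x → Double L y x
    Coset⇒Double {y} (γ , γ∈Γ , refl) = γ , I₂ , γ∈Γ , InΓ₁-I₂ , sym (⊙-identityʳ (γ ⊙ y))

    Double-⊙ʳ : ∀ {γ} x → InΓ₁ L γ → Double L x (x ⊙ γ)
    Double-⊙ʳ {γ} x γ∈Γ = I₂ , γ , InΓ₁-I₂ , γ∈Γ , cong (_⊙ γ) (sym (⊙-identityˡ x))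

    Double-sym : ∀ {α x} → Double L α x → Double L x α
    Double-sym {α} {x} (γ₁ , γ₂ , γ₁∈Γ , γ₂∈Γ , x≡γ₁αγ₂) =
      γ₁ ι , γ₂ ι , InΓ₁-ι γ₁∈Γ , InΓ₁-ι γ₂∈Γ ,
      sym (SL2-moveʳ γ₂ (sl2 γ₂∈Γ) (SL2-moveˡ γ₁ (sl2 γ₁∈Γ) (trans x≡γ₁αγ₂ (⊙-assoc γ₁ α γ₂))))

    Double-trans : ∀ {α x y} → Double L α x → Double L x y → Double L α y
    Double-trans {α} (γ₁ , γ₂ , γ₁∈Γ , γ₂∈Γ , refl) (η₁ , η₂ , η₁∈Γ , η₂∈Γ , refl) =
      η₁ ⊙ γ₁ , γ₂ ⊙ η₂ , InΓ₁-⊙ η₁∈Γ γ₁∈Γ , InΓ₁-⊙ γ₂∈Γ η₂∈Γ , reassociate η₁ γ₁ α γ₂ η₂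
      where
      open import Algebra.Solver.Monoid ⊙-monoid using (solve; _⊕_; _⊜_)
      reassociate : ∀ a b c d e → a ⊙ (b ⊙ c ⊙ d) ⊙ e ≡ a ⊙ b ⊙ c ⊙ (d ⊙ e)
      reassociate = solve 5 (λ a b c d e → (a ⊕ ((b ⊕ c) ⊕ d)) ⊕ e ⊜ ((a ⊕ b) ⊕ c) ⊕ (d ⊕ e)) refl

    Double-det : ∀ {α x} → Double L α x → det x ≡ det α
    Double-det {α} (γ₁ , γ₂ , γ₁∈Γ , γ₂∈Γ , refl) = begin
      det (γ₁ ⊙ α ⊙ γ₂)          ≡⟨ det-⊙ (γ₁ ⊙ α) γ₂ ⟩
      det (γ₁ ⊙ α) * det γ₂      ≡⟨ cong₂ _*_ (det-⊙ γ₁ α) (sl2 γ₂∈Γ) ⟩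
      det γ₁ * det α * + 1       ≡⟨ cong (λ z → z * det α * + 1) (sl2 γ₁∈Γ) ⟩
      + 1 * det α * + 1          ≡⟨ lemma (det α) ⟩
      det α                      ∎
      where
      open ≡-Reasoning
      lemma : ∀ z → + 1 * z * + 1 ≡ z
      lemma = solve-∀

    Double-InΔ : ∀ {n α x} → InΔ L n α → Double L α x → InΔ L n x
    Double-InΔ α∈Δ (γ₁ , γ₂ , γ₁∈Γ , γ₂∈Γ , refl) = InΔ-⊙-InΓ₁ (InΓ₁-⊙-InΔ γ₁∈Γ α∈Δ) γ₂∈Γ

    Double-UpperTriangular : ∀ {p q α x} → Double L α x → UpperTriangular L p q α → UpperTriangular L p q x
    Double-UpperTriangular {p} {q} (γ₁ , γ₂ , γ₁∈Γ , γ₂∈Γ , refl) α-upper =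
      UpperTriangular-convert (≋-reflexive (lemma p)) (≋-reflexive (lemma q))
        (UpperTriangular-⊙ (UpperTriangular-⊙ (upper γ₁∈Γ) α-upper) (upper γ₂∈Γ))
      where
      lemma : ∀ z → + 1 * z * + 1 ≡ z
      lemma = solve-∀

  module _ {K L : ℕ} where

    Double-weakenˡ : ∀ {α x} → Double (K ℕ.* L) α x → Double K α x
    Double-weakenˡ (γ₁ , γ₂ , γ₁∈Γ , γ₂∈Γ , x≡γ₁αγ₂) = γ₁ , γ₂ , InΓ₁-weakenˡ γ₁∈Γ , InΓ₁-weakenˡ γ₂∈Γ , x≡γ₁αγ₂

    Double-weakenʳ : ∀ {α x} → Double (K ℕ.* L) α x → Double L α x
    Double-weakenʳ (γ₁ , γ₂ , γ₁∈Γ , γ₂∈Γ , x≡γ₁αγ₂) = γ₁ , γ₂ , InΓ₁-weakenʳ {K} γ₁∈Γ , InΓ₁-weakenʳ {K} γ₂∈Γ , x≡γ₁αγ₂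

module Reduction (M : ℕ) .{{_ : NonZero M}} where

  open import Defs using (a; b; c; d; _⊙_; _ι; SL2; ZM; red; rowMul)
  open Congruence
  open Matrix using (I₂; ι-anti-⊙; ι-inverseʳ)
  open CongruenceSubgroup using (FirstColumn; firstColumn)
  import Data.Nat.DivMod as ℕ
  open import Data.Integer using (ℤ; +_; _+_; _*_; -_; _%ℕ_)
  import Data.Integer.Properties as ℤ
  import Data.Integer.DivMod as ℤ
  open import Data.Integer.Tactic.RingSolver using (solve-∀)
  open import Data.Fin using (Fin; toℕ)
  import Data.Fin.Properties as Fin
  open import Data.Product using (_×_; _,_; proj₁; proj₂)
  open import Relation.Binary.PropositionalEquality using (_≡_; sym; trans; cong; cong₂; subst; module ≡-Reasoning)

  e₀₁ : ZM M × ZM M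
  e₀₁ = red M (+ 0) , red M (+ 1)

  toℕ-red : ∀ x → toℕ (red M x) ≡ x %ℕ M
  toℕ-red x = trans (Fin.toℕ-fromℕ< (ℕ.m%n<n (x %ℕ M) M)) (ℕ.m<n⇒m%n≡m (ℤ.n%ℕd<d x M))

  %ℕ≋ : ∀ x → + (x %ℕ M) ≋ x [mod M ]
  %ℕ≋ x = ≋-sym (x ℤ./ℕ M , ℤ.a≡a%ℕn+[a/ℕn]*n x M)

  red≋ : ∀ x → + toℕ (red M x) ≋ x [mod M ]
  red≋ x = subst (λ r → + r ≋ x [mod M ]) (sym (toℕ-red x)) (%ℕ≋ x)

  red-cong : ∀ {x y} → x ≋ y [mod M ] → red M x ≡ red M y
  red-cong {x} {y} x≋y = cong (ℕ._mod M)
    (residues-≋⇒≡ (ℤ.n%ℕd<d x M) (ℤ.n%ℕd<d y M) (≋-trans (%ℕ≋ x) (≋-trans x≋y (≋-sym (%ℕ≋ y)))))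

  red≡⇒≋ : ∀ {x y} → red M x ≡ red M y → x ≋ y [mod M ]
  red≡⇒≋ {x} {y} eq = ≋-trans (≋-sym (red≋ x)) (≋-trans (≋-reflexive (cong (λ u → + toℕ u) eq)) (red≋ y))

  red-toℕ : ∀ (u : Fin M) → red M (+ toℕ u) ≡ u
  red-toℕ u = Fin.toℕ-injective (trans (toℕ-red (+ toℕ u)) (ℕ.m<n⇒m%n≡m (Fin.toℕ<n u)))

  rowMul-⊙ : ∀ uv g h → rowMul M (rowMul M uv g) h ≡ rowMul M uv (g ⊙ h)
  rowMul-⊙ (u , v) g h = cong₂ _,_ (red-cong (entry (a h) (c h))) (red-cong (entry (b h) (d h)))
    where
    U V : ℤ
    U = + toℕ u
    V = + toℕ v
    entry : ∀ p q → + toℕ (red M (U * a g + V * c g)) * p + + toℕ (red M (U * b g + V * d g)) * q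
                    ≋ U * (a g * p + b g * q) + V * (c g * p + d g * q) [mod M ]
    entry p q = ≋-trans (≋-+ (≋-* (red≋ (U * a g + V * c g)) ≋-refl) (≋-* (red≋ (U * b g + V * d g)) ≋-refl))
                        (≋-reflexive (lemma U V (a g) (b g) (c g) (d g) p q))
      where
      lemma : ∀ U V a b c d p q → (U * a + V * c) * p + (U * b + V * d) * q ≡
                                  U * (a * p + b * q) + V * (c * p + d * q)
      lemma = solve-∀

  rowMul-I₂ : ∀ uv → rowMul M uv I₂ ≡ uv
  rowMul-I₂ (u , v) = cong₂ _,_
    (trans (cong (red M) (lemma (+ toℕ u) (+ toℕ v))) (red-toℕ u))
    (trans (cong (red M) (lemma′ (+ toℕ u) (+ toℕ v))) (red-toℕ v))
    where
    lemma : ∀ x y → x * + 1 + y * + 0 ≡ x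
    lemma = solve-∀
    lemma′ : ∀ x y → x * + 0 + y * + 1 ≡ y
    lemma′ = solve-∀

  rowMul-e₀₁ : ∀ g → rowMul M e₀₁ g ≡ (red M (c g) , red M (d g))
  rowMul-e₀₁ g = cong₂ _,_ (red-cong (entry (a g) (c g))) (red-cong (entry (b g) (d g)))
    where
    entry : ∀ p q → + toℕ (red M (+ 0)) * p + + toℕ (red M (+ 1)) * q ≋ q [mod M ]
    entry p q = ≋-trans (≋-+ (≋-* (red≋ (+ 0)) ≋-refl) (≋-* (red≋ (+ 1)) ≋-refl))
                        (≋-reflexive (lemma p q))
      where
      lemma : ∀ p q → + 0 * p + + 1 * q ≡ q
      lemma = solve-∀

  bottomRow⇒e₀₁-fixed : ∀ {g} → c g ≋ + 0 [mod M ] → d g ≋ + 1 [mod M ] → rowMul M e₀₁ g ≡ e₀₁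
  bottomRow⇒e₀₁-fixed {g} c≋0 d≋1 = trans (rowMul-e₀₁ g) (cong₂ _,_ (red-cong c≋0) (red-cong d≋1))

  -- The bottom row of g ι is (- c g , a g).
  FirstColumn⇒e₀₁-fixed : ∀ {g} → FirstColumn M (+ 1) g → rowMul M e₀₁ (g ι) ≡ e₀₁
  FirstColumn⇒e₀₁-fixed (firstColumn a≋1 c≋0) = bottomRow⇒e₀₁-fixed (≋-neg c≋0) a≋1

  e₀₁-fixed⇒FirstColumn : ∀ {g} → rowMul M e₀₁ (g ι) ≡ e₀₁ → FirstColumn M (+ 1) g
  e₀₁-fixed⇒FirstColumn {g} fixed = firstColumn (red≡⇒≋ (cong proj₂ bottomRow≡e₀₁))
    (≋-trans (≋-reflexive (sym (ℤ.neg-involutive (c g)))) (≋-neg {y = + 0} (red≡⇒≋ (cong proj₁ bottomRow≡e₀₁))))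
    where
    bottomRow≡e₀₁ : (red M (- c g) , red M (a g)) ≡ e₀₁
    bottomRow≡e₀₁ = trans (sym (rowMul-e₀₁ (g ι))) fixed

  FirstColumn-cancelʳ : ∀ {σ y} → FirstColumn M (+ 1) y → FirstColumn M (+ 1) (σ ⊙ y) → FirstColumn M (+ 1) σ
  FirstColumn-cancelʳ {σ} {y} y-column σy-column = e₀₁-fixed⇒FirstColumn (begin
    rowMul M e₀₁ (σ ι)                    ≡⟨ cong (λ uv → rowMul M uv (σ ι)) (FirstColumn⇒e₀₁-fixed y-column) ⟨
    rowMul M (rowMul M e₀₁ (y ι)) (σ ι)   ≡⟨ rowMul-⊙ e₀₁ (y ι) (σ ι) ⟩
    rowMul M e₀₁ (y ι ⊙ σ ι)              ≡⟨ cong (rowMul M e₀₁) (ι-anti-⊙ σ y) ⟨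
    rowMul M e₀₁ ((σ ⊙ y) ι)              ≡⟨ FirstColumn⇒e₀₁-fixed σy-column ⟩
    e₀₁                                   ∎)
    where open ≡-Reasoning

  FirstColumn-transport : ∀ {σ y} → SL2 σ → rowMul M e₀₁ σ ≡ rowMul M e₀₁ (y ι) → FirstColumn M (+ 1) (σ ⊙ y)
  FirstColumn-transport {σ} {y} σ-sl2 e₀₁σ≡e₀₁yι = e₀₁-fixed⇒FirstColumn (begin
    rowMul M e₀₁ ((σ ⊙ y) ι)             ≡⟨ cong (rowMul M e₀₁) (ι-anti-⊙ σ y) ⟩
    rowMul M e₀₁ (y ι ⊙ σ ι)             ≡⟨ rowMul-⊙ e₀₁ (y ι) (σ ι) ⟨
    rowMul M (rowMul M e₀₁ (y ι)) (σ ι)  ≡⟨ cong (λ uv → rowMul M uv (σ ι)) e₀₁σ≡e₀₁yι ⟨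
    rowMul M (rowMul M e₀₁ σ) (σ ι)      ≡⟨ rowMul-⊙ e₀₁ σ (σ ι) ⟩
    rowMul M e₀₁ (σ ⊙ σ ι)               ≡⟨ cong (rowMul M e₀₁) (ι-inverseʳ σ σ-sl2) ⟩
    rowMul M e₀₁ I₂                      ≡⟨ rowMul-I₂ e₀₁ ⟩
    e₀₁                                  ∎)
    where open ≡-Reasoning

module Transitivity where

  open import Defs using (Mat; mat; a; b; c; d; _⊙_; SL2; red; rowMul; Generates; _≡_[mod_])
  open Congruence
  open Matrix
  open CongruenceSubgroup
  open import Data.Nat as ℕ using (ℕ; NonZero)
  import Data.Nat.Properties as ℕ
  import Data.Nat.DivMod as ℕ
  import Data.Nat.Divisibility as ℕ
  open import Data.Nat.Coprimality using (Coprime; coprime-/gcd)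
  open import Function using (_∘_)
  open import Data.Nat.GCD using (gcd; gcd[m,n]∣m; gcd[m,n]∣n; gcd[m,n]≢0)
  open import Data.Integer using (ℤ; +_; _+_; _-_; _*_; -_; ∣_∣; _%ℕ_)
  import Data.Integer.Properties as ℤ
  import Data.Integer.DivMod as ℤ
  import Data.Integer.Divisibility.Signed as Signed
  open import Data.Integer.Tactic.RingSolver using (solve-∀)
  open import Data.Fin using (Fin; toℕ)
  import Data.Fin.Properties as Fin
  open import Data.Product using (Σ-syntax; _×_; _,_)
  open import Data.Sum using (inj₂)
  open import Relation.Nullary using (Dec)
  import Relation.Nullary.Decidable as Dec
  open import Relation.Binary.PropositionalEquality
    using (_≡_; _≢_; refl; sym; trans; cong; cong₂; subst; module ≡-Reasoning)

  -- The coefficients may be taken among the residues mod M, so a finite search decides Generates;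
  -- _≡_[mod M ] on ℤ unfolds to divisibility of an absolute value in ℕ.
  generates? : ∀ M .{{_ : NonZero M}} uv → Dec (Generates M uv)
  generates? M (u , v) = Dec.map′ widen narrow
    (Fin.any? λ x → Fin.any? λ y → M ℕ.∣? ∣ + toℕ x * + toℕ u + + toℕ y * + toℕ v - + 1 ∣)
    where
    open Reduction M using (red≋)
    SmallWitness : Set
    SmallWitness = Σ[ x ∈ Fin M ] Σ[ y ∈ Fin M ] ((+ toℕ x * + toℕ u + + toℕ y * + toℕ v) ≡ + 1 [mod M ])
    widen : SmallWitness → Generates M (u , v)
    widen (x , y , xu+yv≡1) = + toℕ x , + toℕ y , xu+yv≡1
    narrow : Generates M (u , v) → SmallWitness
    narrow (x , y , xu+yv≡1) = red M x , red M y , ≋⇒≡mod (≋-trans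
      (≋-+ (≋-* (red≋ x) (≋-refl {x = + toℕ u})) (≋-* (red≋ y) (≋-refl {x = + toℕ v})))
      (≡mod⇒≋ xu+yv≡1))

  SL2-completion : ∀ {m n} → Coprime m n → Σ[ σ ∈ Mat ] SL2 σ × c σ ≡ + m × d σ ≡ + n
  SL2-completion {m} {n} coprime with bézout coprime
  ... | s , t , sm+tn≡1 = mat t (- s) (+ m) (+ n) , trans (lemma s t (+ m) (+ n)) sm+tn≡1 , refl , refl
    where
    lemma : ∀ s t m n → t * n - - s * m ≡ s * m + t * n
    lemma = solve-∀

  gcd-coprime-modulus : ∀ {K x y} cn dn → x * + cn + y * + dn ≋ + 1 [mod K ] → Coprime (gcd cn dn) K
  gcd-coprime-modulus {K} {x} {y} cn dn (q , comb≡1+qK) {h} (h∣g , h∣K) =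
    ℕ.∣1⇒≡1 (Signed.∣⇒∣ᵤ (subst (+ h Signed.∣_) comb-qK≡1 h∣comb-qK))
    where
    h∣comb-qK : + h Signed.∣ x * + cn + y * + dn - q * + K
    h∣comb-qK = Signed.∣m∣n⇒∣m-n
      (Signed.∣m∣n⇒∣m+n (Signed.∣n⇒∣m*n x (Signed.∣ᵤ⇒∣ (ℕ.∣-trans h∣g (gcd[m,n]∣m cn dn))))
                        (Signed.∣n⇒∣m*n y (Signed.∣ᵤ⇒∣ (ℕ.∣-trans h∣g (gcd[m,n]∣n cn dn)))))
      (Signed.∣n⇒∣m*n q (Signed.∣ᵤ⇒∣ h∣K))
    comb-qK≡1 : x * + cn + y * + dn - q * + K ≡ + 1
    comb-qK≡1 = trans (cong (_- q * + K) comb≡1+qK) (lemma q (+ K))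
      where
      lemma : ∀ q k → + 1 + q * k - q * k ≡ + 1
      lemma = solve-∀

  -- The witness is (s -t ; K g) ⊙ σ₁, where σ₁ completes (c₁, d₁) and s g + t K = 1.
  lift-scaled-primitive : ∀ K {g c₁ d₁} → Coprime c₁ d₁ → Coprime g K →
                          Σ[ σ ∈ Mat ] SL2 σ × c σ ≋ + (g ℕ.* c₁) [mod K ] × d σ ≋ + (g ℕ.* d₁) [mod K ]
  lift-scaled-primitive K {g} {c₁} {d₁} c₁⊥d₁ g⊥K =
    let σ₁ , σ₁-sl2 , c≡c₁ , d≡d₁ = SL2-completion c₁⊥d₁
        s , t , sg+tK≡1 = bézout g⊥K
        D = mat s (- t) (+ K) (+ g)
    in D ⊙ σ₁ , SL2-⊙ D σ₁ (trans (det-D s t (+ g) (+ K)) sg+tK≡1) σ₁-sl2 ,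
       (a σ₁ , row-entry (a σ₁) c≡c₁) , (b σ₁ , row-entry (b σ₁) d≡d₁)
    where
    open ≡-Reasoning
    det-D : ∀ s t g k → s * g - - t * k ≡ s * g + t * k
    det-D = solve-∀
    row-entry : ∀ {w n} u → w ≡ + n → + K * u + + g * w ≡ + (g ℕ.* n) + u * + K
    row-entry {n = n} u refl = begin
      + K * u + + g * + n       ≡⟨ lemma (+ K) u (+ g) (+ n) ⟩
      + g * + n + u * + K       ≡⟨ cong (_+ u * + K) (ℤ.pos-* g n) ⟨
      + (g ℕ.* n) + u * + K     ∎
      where
      lemma : ∀ k u g n → k * u + g * n ≡ g * n + u * k
      lemma = solve-∀

  -- Take representatives cn, dn ≥ 0 of c₀, d₀ with dn ≠ 0; their gcd is a unit mod K.
  SL2-lift-bottomRow : ∀ K .{{_ : NonZero K}} {x y c₀ d₀} → x * c₀ + y * d₀ ≋ + 1 [mod K ] →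
                       Σ[ σ ∈ Mat ] SL2 σ × c σ ≋ c₀ [mod K ] × d σ ≋ d₀ [mod K ]
  SL2-lift-bottomRow K {x} {y} {c₀} {d₀} comb≋1 =
    unreduce (lift-scaled-primitive K (coprime-/gcd cn dn {{gcd≢0}}) (gcd-coprime-modulus {K} {x} {y} cn dn comb′≋1))
    where
    open Reduction K using (%ℕ≋)
    cn dn : ℕ
    cn = c₀ %ℕ K
    dn = d₀ %ℕ K ℕ.+ K
    dn≋d₀ : + dn ≋ d₀ [mod K ]
    dn≋d₀ = ≋-trans (+ 1 , trans (ℤ.pos-+ (d₀ %ℕ K) K) (cong (_+_ (+ (d₀ %ℕ K))) (sym (ℤ.*-identityˡ (+ K)))))
                    (%ℕ≋ d₀)
    gcd≢0 : NonZero (gcd cn dn)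
    gcd≢0 = ℕ.≢-nonZero (gcd[m,n]≢0 cn dn (inj₂ (ℕ.≢-nonZero⁻¹ K ∘ ℕ.m+n≡0⇒n≡0 (d₀ %ℕ K))))
    comb′≋1 : x * + cn + y * + dn ≋ + 1 [mod K ]
    comb′≋1 = ≋-trans (≋-+ (≋-* (≋-refl {x = x}) (%ℕ≋ c₀)) (≋-* (≋-refl {x = y}) dn≋d₀)) comb≋1
    g : ℕ
    g = gcd cn dn
    g*[n/g]≡n : ∀ {n} → g ℕ.∣ n → + (g ℕ.* (n ℕ./ g) {{gcd≢0}}) ≡ + n
    g*[n/g]≡n g∣n = cong +_ (ℕ.m*[n/m]≡n {{gcd≢0}} g∣n)
    unreduce : Σ[ σ ∈ Mat ] SL2 σ × c σ ≋ + (g ℕ.* (cn ℕ./ g) {{gcd≢0}}) [mod K ]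
                                  × d σ ≋ + (g ℕ.* (dn ℕ./ g) {{gcd≢0}}) [mod K ] →
               Σ[ σ ∈ Mat ] SL2 σ × c σ ≋ c₀ [mod K ] × d σ ≋ d₀ [mod K ]
    unreduce (σ , σ-sl2 , c≋cn , d≋dn) =
      σ , σ-sl2 , ≋-trans c≋cn (≋-trans (≋-reflexive (g*[n/g]≡n (gcd[m,n]∣m cn dn))) (%ℕ≋ c₀)) ,
                  ≋-trans d≋dn (≋-trans (≋-reflexive (g*[n/g]≡n (gcd[m,n]∣n cn dn))) dn≋d₀)

  module _ {N M : ℕ} .{{_ : NonZero N}} .{{_ : NonZero M}} (coprime : Coprime N M) where

    open Reduction M using (e₀₁; rowMul-e₀₁; red-cong; red-toℕ)

    instance
      NM≢0 : NonZero (N ℕ.* M)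
      NM≢0 = ℕ.m*n≢0 N M

    -- By CRT, lift the row ≡ (0,1) mod N and ≡ (u,v) mod M to a row that is primitive mod N M,
    -- and complete it to a matrix of SL₂(ℤ).
    Γ₁-transitive : ∀ uv → Generates M uv → Σ[ σ ∈ Mat ] InΓ₁ N σ × rowMul M e₀₁ σ ≡ uv
    Γ₁-transitive (u , v) (x , y , xu+yv≡1) =
      let c₀ , c₀≋0 , c₀≋u = chinese-remainder coprime (+ 0) (+ toℕ u)
          d₀ , d₀≋1 , d₀≋v = chinese-remainder coprime (+ 1) (+ toℕ v)
          x₀ , x₀≋0 , x₀≋x = chinese-remainder coprime (+ 0) x
          y₀ , y₀≋1 , y₀≋y = chinese-remainder coprime (+ 1) y
          comb≋1ᴺ : x₀ * c₀ + y₀ * d₀ ≋ + 1 [mod N ]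
          comb≋1ᴺ = ≋-+ (≋-* x₀≋0 c₀≋0) (≋-* y₀≋1 d₀≋1)
          comb≋1ᴹ : x₀ * c₀ + y₀ * d₀ ≋ + 1 [mod M ]
          comb≋1ᴹ = ≋-trans (≋-+ (≋-* x₀≋x c₀≋u) (≋-* y₀≋y d₀≋v)) (≡mod⇒≋ xu+yv≡1)
          σ , σ-sl2 , c≋c₀ , d≋d₀ = SL2-lift-bottomRow (N ℕ.* M) {x₀} {y₀} {c₀} {d₀} (≋-crt coprime comb≋1ᴺ comb≋1ᴹ)
          c≋0 : c σ ≋ + 0 [mod N ]
          c≋0 = ≋-trans (≋-weakenˡ c≋c₀) c₀≋0
          d≋1 : d σ ≋ + 1 [mod N ]
          d≋1 = ≋-trans (≋-weakenˡ d≋d₀) d₀≋1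
      in σ , inΓ₁ σ-sl2 (upperTriangular (firstColumn (SL2-d≋1⇒a≋1 σ σ-sl2 c≋0 d≋1) c≋0) d≋1) ,
         trans (rowMul-e₀₁ σ) (cong₂ _,_ (trans (red-cong (≋-trans (≋-weakenʳ {N} c≋c₀) c₀≋u)) (red-toℕ u))
                                         (trans (red-cong (≋-trans (≋-weakenʳ {N} d≋d₀) d₀≋v)) (red-toℕ v)))

module FiniteSum {c ℓ} (G : AbelianGroup c ℓ) where

  open import Defs using (sumFin)
  open import Level using (Level; 0ℓ; _⊔_) renaming (suc to lsuc)
  open import Data.Bool using (if_then_else_)
  open import Data.Nat using (ℕ; zero; suc)
  open import Data.Fin as Fin using (Fin)
  import Data.Fin.Properties as Fin
  open import Data.List using (List; []; _∷_; _++_; map; concatMap; tabulate; allFin)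
  open import Data.Product using (Σ; Σ-syntax; _,_; proj₁)
  import Data.Product.Properties as Σ
  open import Data.Sum using (_⊎_; inj₁; inj₂)
  open import Data.Empty using (⊥-elim)
  open import Function using (_∘_; id; _⇔_; Equivalence; mk⇔)
  open import Relation.Nullary using (Dec; yes; no; does; ¬_)
  open import Relation.Binary.Definitions using (DecidableEquality)
  open import Relation.Binary.PropositionalEquality as ≡ using (_≡_; _≢_)

  open AbelianGroup G renaming (Carrier to A)
  open import Algebra.Properties.AbelianGroup G using (ε⁻¹≈ε; ⁻¹-∙-comm)
  open import Algebra.Properties.CommutativeSemigroup commutativeSemigroup using (interchange)
  open import Relation.Binary.Reasoning.Setoid setoid

  private
    variable
      ℓᵢ ℓⱼ : Level
      I : Set ℓᵢ
      J : Set ℓⱼ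

  ∑ : List I → (I → A) → A
  ∑ []       f = ε
  ∑ (x ∷ xs) f = f x ∙ ∑ xs f

  syntax ∑ xs (λ i → e) = ∑[ i ← xs ] e

  ∑-cong : ∀ xs {f g : I → A} → (∀ x → f x ≈ g x) → ∑ xs f ≈ ∑ xs g
  ∑-cong []       f≈g = refl
  ∑-cong (x ∷ xs) f≈g = ∙-cong (f≈g x) (∑-cong xs f≈g)

  ∑-zero : ∀ xs {f : I → A} → (∀ x → f x ≈ ε) → ∑ xs f ≈ ε
  ∑-zero []       f≈ε = refl
  ∑-zero (x ∷ xs) f≈ε = trans (∙-cong (f≈ε x) (∑-zero xs f≈ε)) (identityˡ ε)

  ∑-distrib : ∀ xs (f g : I → A) → ∑[ x ← xs ] (f x ∙ g x) ≈ ∑ xs f ∙ ∑ xs g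
  ∑-distrib []       f g = sym (identityˡ ε)
  ∑-distrib (x ∷ xs) f g = begin
    (f x ∙ g x) ∙ ∑[ y ← xs ] (f y ∙ g y)  ≈⟨ ∙-congˡ (∑-distrib xs f g) ⟩
    (f x ∙ g x) ∙ (∑ xs f ∙ ∑ xs g)        ≈⟨ interchange (f x) (g x) (∑ xs f) (∑ xs g) ⟩
    (f x ∙ ∑ xs f) ∙ (g x ∙ ∑ xs g)        ∎

  ∑-comm : ∀ xs (ys : List J) (f : I → J → A) →
           ∑[ x ← xs ] ∑ ys (f x) ≈ ∑[ y ← ys ] ∑[ x ← xs ] f x y
  ∑-comm []       ys f = sym (∑-zero ys (λ _ → refl))
  ∑-comm (x ∷ xs) ys f =
    trans (∙-congˡ (∑-comm xs ys f)) (sym (∑-distrib ys (f x) (λ y → ∑[ x ← xs ] f x y)))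

  ∑-homo : ∀ (h : A → A) → (∀ {u v} → u ≈ v → h u ≈ h v) → (∀ u v → h (u ∙ v) ≈ h u ∙ h v) → h ε ≈ ε →
           ∀ xs (f : I → A) → h (∑ xs f) ≈ ∑[ x ← xs ] h (f x)
  ∑-homo h h-cong h-∙ h-ε []       f = h-ε
  ∑-homo h h-cong h-∙ h-ε (x ∷ xs) f = trans (h-∙ (f x) (∑ xs f)) (∙-congˡ (∑-homo h h-cong h-∙ h-ε xs f))

  ∑-⁻¹ : ∀ xs (f : I → A) → ∑ xs f ⁻¹ ≈ ∑[ x ← xs ] (f x ⁻¹)
  ∑-⁻¹ = ∑-homo _⁻¹ ⁻¹-cong (λ u v → sym (⁻¹-∙-comm u v)) ε⁻¹≈ε

  ∑-++ : ∀ xs ys (f : I → A) → ∑ (xs ++ ys) f ≈ ∑ xs f ∙ ∑ ys f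
  ∑-++ []       ys f = sym (identityˡ _)
  ∑-++ (x ∷ xs) ys f = trans (∙-congˡ (∑-++ xs ys f)) (sym (assoc _ _ _))

  ∑-map : ∀ (φ : J → I) xs (f : I → A) → ∑ (map φ xs) f ≡ ∑ xs (f ∘ φ)
  ∑-map φ []       f = ≡.refl
  ∑-map φ (x ∷ xs) f = ≡.cong (f (φ x) ∙_) (∑-map φ xs f)

  ∑-concatMap : ∀ (k : J → List I) xs (f : I → A) →
                ∑ (concatMap k xs) f ≈ ∑[ x ← xs ] ∑ (k x) f
  ∑-concatMap k []       f = refl
  ∑-concatMap k (x ∷ xs) f = trans (∑-++ (k x) (concatMap k xs) f) (∙-congˡ (∑-concatMap k xs f))

  ∑-tabulate : ∀ {n} (h : Fin n → I) (f : I → A) → ∑ (tabulate h) f ≡ sumFin _∙_ ε (f ∘ h)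
  ∑-tabulate {n = zero}  h f = ≡.refl
  ∑-tabulate {n = suc n} h f = ≡.cong (f (h Fin.zero) ∙_) (∑-tabulate (h ∘ Fin.suc) f)

  when : ∀ {p} {P : Set p} → Dec P → A → A
  when d x = if does d then x else ε

  when-⇔ : ∀ {p q} {P : Set p} {Q : Set q} → P ⇔ Q → (d : Dec P) (d′ : Dec Q) → ∀ x → when d x ≈ when d′ x
  when-⇔ P⇔Q (yes p) (yes q) x = refl
  when-⇔ P⇔Q (yes p) (no ¬q) x = ⊥-elim (¬q (Equivalence.to P⇔Q p))
  when-⇔ P⇔Q (no ¬p) (yes q) x = ⊥-elim (¬p (Equivalence.from P⇔Q q))
  when-⇔ P⇔Q (no ¬p) (no ¬q) x = refl

  when-¬ : ∀ {p} {P : Set p} (d : Dec P) → ¬ P → ∀ x → when d x ≈ ε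
  when-¬ (yes p) ¬p x = ⊥-elim (¬p p)
  when-¬ (no _)  ¬p x = refl

  when-ε : ∀ {p} {P : Set p} (d : Dec P) {x} → x ≈ ε → when d x ≈ ε
  when-ε (yes _) x≈ε = x≈ε
  when-ε (no _)  x≈ε = refl

  when-absorb : ∀ {p} {P : Set p} (d : Dec P) {x} → (¬ P → x ≈ ε) → x ≈ when d x
  when-absorb (yes _) ¬P⇒x≈ε = refl
  when-absorb (no ¬p) ¬P⇒x≈ε = ¬P⇒x≈ε ¬p

  -- A finite type listed without repetition, the listing property being phrased as: summing an
  -- indicator over the list picks out exactly one term.
  record FiniteIndex : Set (lsuc 0ℓ ⊔ c ⊔ ℓ) where
    field
      Carrier  : Set
      _≟_      : DecidableEquality Carrier
      elements : List Carrier
      ∑-when-≡ : ∀ j (g : Carrier → A) → ∑[ i ← elements ] when (i ≟ j) (g i) ≈ g j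

  ∑-allFin-suc : ∀ {n} (f : Fin (suc n) → A) → ∑ (allFin (suc n)) f ≡ f Fin.zero ∙ ∑[ i ← allFin n ] f (Fin.suc i)
  ∑-allFin-suc f = ≡.trans (∑-tabulate id f) (≡.cong (f Fin.zero ∙_) (≡.sym (∑-tabulate id (f ∘ Fin.suc))))

  ∑-when-≡-Fin : ∀ {n} (j : Fin n) (g : Fin n → A) → ∑[ i ← allFin n ] when (i Fin.≟ j) (g i) ≈ g j
  ∑-when-≡-Fin {suc n} Fin.zero g = begin
    ∑[ i ← allFin (suc n) ] when (i Fin.≟ Fin.zero) (g i)  ≡⟨ ∑-allFin-suc (λ i → when (i Fin.≟ Fin.zero) (g i)) ⟩
    g Fin.zero ∙ ∑[ i ← allFin n ] ε                       ≈⟨ ∙-congˡ (∑-zero (allFin n) (λ _ → refl)) ⟩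
    g Fin.zero ∙ ε                                         ≈⟨ identityʳ _ ⟩
    g Fin.zero                                             ∎
  ∑-when-≡-Fin {suc n} (Fin.suc j) g = begin
    ∑[ i ← allFin (suc n) ] when (i Fin.≟ Fin.suc j) (g i)    ≡⟨ ∑-allFin-suc (λ i → when (i Fin.≟ Fin.suc j) (g i)) ⟩
    ε ∙ ∑[ i ← allFin n ] when (i Fin.≟ j) (g (Fin.suc i))    ≈⟨ identityˡ _ ⟩
    ∑[ i ← allFin n ] when (i Fin.≟ j) (g (Fin.suc i))        ≈⟨ ∑-when-≡-Fin j (g ∘ Fin.suc) ⟩
    g (Fin.suc j)                                             ∎

  Fin-index : ℕ → FiniteIndex
  Fin-index n = record
    { Carrier = Fin n ; _≟_ = Fin._≟_ ; elements = allFin n ; ∑-when-≡ = ∑-when-≡-Fin }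

  module _ (m : ℕ) (size : Fin m → ℕ) where

    Pair : Set
    Pair = Σ (Fin m) (Fin ∘ size)

    pairs : List Pair
    pairs = concatMap (λ k → map (k ,_) (allFin (size k))) (allFin m)

    ∑-pairs : ∀ (f : Pair → A) → ∑ pairs f ≈ ∑[ k ← allFin m ] ∑[ i ← allFin (size k) ] f (k , i)
    ∑-pairs f = trans (∑-concatMap _ (allFin m) f)
                      (∑-cong (allFin m) (λ k → reflexive (∑-map (k ,_) (allFin (size k)) f)))

    private
      _≟ₚ_ : DecidableEquality Pair
      _≟ₚ_ = Σ.≡-dec Fin._≟_ Fin._≟_

      ∑-when-≡-Pair : ∀ j (g : Pair → A) → ∑[ i ← pairs ] when (i ≟ₚ j) (g i) ≈ g j
      ∑-when-≡-Pair (l , j) g = begin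
        ∑[ p ← pairs ] when (p ≟ₚ (l , j)) (g p)
          ≈⟨ ∑-pairs _ ⟩
        ∑[ k ← allFin m ] H k
          ≈⟨ ∑-cong (allFin m) (λ k → when-absorb (k Fin.≟ l) (H-off k)) ⟩
        ∑[ k ← allFin m ] when (k Fin.≟ l) (H k)
          ≈⟨ ∑-when-≡-Fin l H ⟩
        H l
          ≈⟨ ∑-cong (allFin (size l)) (λ i → when-⇔ same-row ((l , i) ≟ₚ (l , j)) (i Fin.≟ j) _) ⟩
        ∑[ i ← allFin (size l) ] when (i Fin.≟ j) (g (l , i))
          ≈⟨ ∑-when-≡-Fin j (λ i → g (l , i)) ⟩
        g (l , j)
          ∎
        where
        H : Fin m → A
        H k = ∑[ i ← allFin (size k) ] when ((k , i) ≟ₚ (l , j)) (g (k , i))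
        H-off : ∀ k → k ≢ l → H k ≈ ε
        H-off k k≢l = ∑-zero (allFin (size k)) (λ i → when-¬ ((k , i) ≟ₚ (l , j)) (k≢l ∘ ≡.cong proj₁) _)
        same-row : ∀ {i} → ((l , i) ≡ (l , j)) ⇔ (i ≡ j)
        same-row = mk⇔ (λ { ≡.refl → ≡.refl }) (≡.cong (l ,_))

    Σ-index : FiniteIndex
    Σ-index = record { Carrier = Pair ; _≟_ = _≟ₚ_ ; elements = pairs ; ∑-when-≡ = ∑-when-≡-Pair }

  module _ (I J : FiniteIndex) where

    private
      module I = FiniteIndex I
      module J = FiniteIndex J

    -- Each term f i is spread as Σⱼ [φ j = i] f i, and the double sum is summed the other way.
    ∑-reindex : (φ : J.Carrier → I.Carrier) → (∀ {x y} → φ x ≡ φ y → x ≡ y) → (f : I.Carrier → A) →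
                (∀ i → (Σ[ j ∈ J.Carrier ] φ j ≡ i) ⊎ f i ≈ ε) →
                ∑ I.elements f ≈ ∑[ j ← J.elements ] f (φ j)
    ∑-reindex φ φ-injective f image-or-ε = begin
      ∑ I.elements f                                                    ≈⟨ ∑-cong I.elements spread ⟩
      ∑[ i ← I.elements ] ∑[ j ← J.elements ] when (φ j I.≟ i) (f i)   ≈⟨ ∑-comm I.elements J.elements _ ⟩
      ∑[ j ← J.elements ] ∑[ i ← I.elements ] when (φ j I.≟ i) (f i)   ≈⟨ ∑-cong J.elements (λ j → ∑-cong I.elements (λ i →
                                                                            when-⇔ (mk⇔ ≡.sym ≡.sym) (φ j I.≟ i) (i I.≟ φ j) _)) ⟩
      ∑[ j ← J.elements ] ∑[ i ← I.elements ] when (i I.≟ φ j) (f i)   ≈⟨ ∑-cong J.elements (λ j → I.∑-when-≡ (φ j) f) ⟩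
      ∑[ j ← J.elements ] f (φ j)                                       ∎
      where
      spread : ∀ i → f i ≈ ∑[ j ← J.elements ] when (φ j I.≟ i) (f i)
      spread i with image-or-ε i
      ... | inj₂ fi≈ε = trans fi≈ε (sym (∑-zero J.elements (λ j → when-ε (φ j I.≟ i) fi≈ε)))
      ... | inj₁ (j₀ , ≡.refl) = sym (begin
        ∑[ j ← J.elements ] when (φ j I.≟ φ j₀) (f (φ j₀))  ≈⟨ ∑-cong J.elements (λ j →
                                                                  when-⇔ (mk⇔ φ-injective (≡.cong φ)) (φ j I.≟ φ j₀) (j J.≟ j₀) _) ⟩
        ∑[ j ← J.elements ] when (j J.≟ j₀) (f (φ j₀))      ≈⟨ J.∑-when-≡ j₀ (λ _ → f (φ j₀)) ⟩
        f (φ j₀)                                            ∎)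

module Action {r ℓr v ℓv} {R : Ring r ℓr} {V : LeftModule R v ℓv} (𝒜 : MatAction V) where

  open import Defs using (Mat; _⊙_; _ι; NonzeroDet; Γ₁; rowMul; Generates; WCarrier; IsWCocycle; Cohomologous)
  open Matrix
  open CongruenceSubgroup using (InΓ₁; InΓ₁⇒Γ₁; InΓ₁-ι; InΓ₁-I₂; sl2)
  open import Algebra.Bundles using (AbelianGroup)
  open import Data.Nat using (ℕ; NonZero)
  open import Data.List using (List)
  open import Data.Product using (_,_; proj₁; proj₂)
  open import Function using (_∘_)
  open import Relation.Nullary using (¬_)
  open import Relation.Binary.PropositionalEquality as ≡ using (_≡_)

  open LeftModule V using (+ᴹ-abelianGroup)
  open AbelianGroup +ᴹ-abelianGroup renaming (Carrier to Vec)
  open import Algebra.Properties.AbelianGroup +ᴹ-abelianGroup using (identityʳ-unique; inverseʳ-unique)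
  open FiniteSum +ᴹ-abelianGroup using (∑; ∑-homo)
  open import Relation.Binary.Reasoning.Setoid setoid
  open MatAction 𝒜

  act-ε : ∀ g → NonzeroDet g → act g ε ≈ ε
  act-ε g det≢0 = identityʳ-unique (act g ε) (act g ε)
    (trans (sym (act-+ g det≢0 ε ε)) (act-cong g det≢0 (identityˡ ε)))

  act-⁻¹ : ∀ g → NonzeroDet g → ∀ x → act g (x ⁻¹) ≈ act g x ⁻¹
  act-⁻¹ g det≢0 x = inverseʳ-unique (act g x) (act g (x ⁻¹))
    (trans (sym (act-+ g det≢0 x (x ⁻¹))) (trans (act-cong g det≢0 (inverseʳ x)) (act-ε g det≢0)))

  act-∑ : ∀ g → NonzeroDet g → ∀ {i} {I : Set i} (xs : List I) (f : I → Vec) →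
          act g (∑ xs f) ≈ ∑ xs (act g ∘ f)
  act-∑ g det≢0 = ∑-homo (act g) (act-cong g det≢0) (act-+ g det≢0) (act-ε g det≢0)

  act-≡ : ∀ {g h} → g ≡ h → ∀ x → act g x ≈ act h x
  act-≡ ≡.refl x = refl

  module WCocycle {M L : ℕ} .{{_ : NonZero M}} (c : Mat → WCarrier V M)
                  (c-cocycle : IsWCocycle V 𝒜 M (Γ₁ L) c) where

    open Reduction M using (rowMul-I₂)

    vanishes : ∀ {g} → InΓ₁ L g → ∀ uv → ¬ Generates M uv → c g uv ≈ ε
    vanishes g∈Γ = proj₁ c-cocycle _ (InΓ₁⇒Γ₁ g∈Γ)

    expand : ∀ {g h} → InΓ₁ L g → InΓ₁ L h → ∀ uv → c (g ⊙ h) uv ≈ c g uv ∙ act g (c h (rowMul M uv g))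
    expand {g} {h} g∈Γ h∈Γ = proj₂ c-cocycle g h (InΓ₁⇒Γ₁ g∈Γ) (InΓ₁⇒Γ₁ h∈Γ)

    -- MatAction does not make I₂ act trivially, so c I₂ only vanishes after acting.
    act-I₂-c-I₂ : ∀ uv → act I₂ (c I₂ uv) ≈ ε
    act-I₂-c-I₂ uv = identityʳ-unique (c I₂ uv) (act I₂ (c I₂ uv)) (sym (begin
      c I₂ uv                                    ≡⟨ ≡.cong (λ h → c h uv) (⊙-identityˡ I₂) ⟨
      c (I₂ ⊙ I₂) uv                             ≈⟨ expand InΓ₁-I₂ InΓ₁-I₂ uv ⟩
      c I₂ uv ∙ act I₂ (c I₂ (rowMul M uv I₂))   ≡⟨ ≡.cong (λ x → c I₂ uv ∙ act I₂ (c I₂ x)) (rowMul-I₂ uv) ⟩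
      c I₂ uv ∙ act I₂ (c I₂ uv)                 ∎))

    act-c-I₂ : ∀ h → NonzeroDet h → ∀ uv → act h (c I₂ uv) ≈ ε
    act-c-I₂ h det≢0 uv = begin
      act h (c I₂ uv)             ≈⟨ act-≡ (⊙-identityʳ h) _ ⟨
      act (h ⊙ I₂) (c I₂ uv)      ≈⟨ act-∘ h I₂ det≢0 (SL2⇒NonzeroDet I₂ SL2-I₂) _ ⟩
      act h (act I₂ (c I₂ uv))    ≈⟨ act-cong h det≢0 (act-I₂-c-I₂ uv) ⟩
      act h ε                     ≈⟨ act-ε h det≢0 ⟩
      ε                           ∎

    act-c-ι : ∀ {τ} → InΓ₁ L τ → ∀ uv → act τ (c (τ ι) (rowMul M uv τ)) ≈ c τ uv ⁻¹ ∙ c I₂ uv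
    act-c-ι {τ} τ∈Γ uv = begin
      act τ (c (τ ι) (rowMul M uv τ))                         ≈⟨ identityˡ _ ⟨
      ε ∙ act τ (c (τ ι) (rowMul M uv τ))                     ≈⟨ ∙-congʳ (inverseˡ (c τ uv)) ⟨
      (c τ uv ⁻¹ ∙ c τ uv) ∙ act τ (c (τ ι) (rowMul M uv τ))  ≈⟨ assoc _ _ _ ⟩
      c τ uv ⁻¹ ∙ (c τ uv ∙ act τ (c (τ ι) (rowMul M uv τ)))  ≈⟨ ∙-congˡ (expand τ∈Γ (InΓ₁-ι τ∈Γ) uv) ⟨
      c τ uv ⁻¹ ∙ c (τ ⊙ τ ι) uv                              ≡⟨ ≡.cong (λ h → c τ uv ⁻¹ ∙ c h uv) (ι-inverseʳ τ (sl2 τ∈Γ)) ⟩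
      c τ uv ⁻¹ ∙ c I₂ uv                                     ∎

  Cohomologous-cong : ∀ {Γ c₁ c₁′ c₂ c₂′} → (∀ g → c₁ g ≈ c₁′ g) → (∀ g → c₂ g ≈ c₂′ g) →
                      Cohomologous V 𝒜 Γ c₁′ c₂′ → Cohomologous V 𝒜 Γ c₁ c₂
  Cohomologous-cong c₁≈c₁′ c₂≈c₂′ (v , c₁′∼c₂′) =
    v , λ g g∈Γ → trans (c₁≈c₁′ g) (trans (c₁′∼c₂′ g g∈Γ) (∙-congʳ (sym (c₂≈c₂′ g))))

module CosetSystems {r ℓr v ℓv} {R : Ring r ℓr} {V : LeftModule R v ℓv} (𝒜 : MatAction V)
                    (M : ℕ) .{{_ : NonZero M}} where

  open import Defs
    using ( Mat; _⊙_; det; _ι; NonzeroDet; Γ₁; ZM; rowMul; WCarrier; _+W_; 0W; actW; sumFin; Sh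
          ; CosetDecomp; HeckeData; Tα; TαV; TαW; Tn; TnV; TnW; InDouble )
  open Matrix
  open CongruenceSubgroup
  open Reduction M using (e₀₁)
  open import Level using (0ℓ; _⊔_) renaming (suc to lsuc)
  open import Algebra.Bundles using (AbelianGroup)
  open import Data.Nat using (zero; suc)
  open import Data.Integer using (ℤ; +_)
  open import Data.Fin as Fin using (Fin)
  open import Data.Product using (Σ; Σ-syntax; _×_; _,_; proj₁; proj₂)
  open import Function using (_∘_; id)
  open import Data.List using (allFin)
  open import Relation.Binary.PropositionalEquality as ≡ using (_≡_; _≢_)

  open LeftModule V using (+ᴹ-abelianGroup)
  open AbelianGroup +ᴹ-abelianGroup renaming (Carrier to Vec)
  open FiniteSum +ᴹ-abelianGroup
  open MatAction 𝒜 using (act)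

  record CosetSystem (L : ℕ) : Set (lsuc 0ℓ ⊔ v ⊔ ℓv) where
    field
      index : FiniteIndex
    open FiniteIndex index public
    field
      δ        : Carrier → Mat
      D        : ℤ
      det-δ    : ∀ i → det (δ i) ≡ D
      D≢0      : D ≢ + 0
      jγ       : Carrier → Mat → Carrier × Mat
      jγ-ok    : ∀ i g → InΓ₁ L g →
                 InΓ₁ L (proj₂ (jγ i g)) × δ i ⊙ g ≡ proj₂ (jγ i g) ⊙ δ (proj₁ (jγ i g))
      disjoint : ∀ i j → Coset L (δ j) (δ i) → i ≡ j
      jγ-onto  : ∀ g → InΓ₁ L g → ∀ j → Σ[ i ∈ Carrier ] proj₁ (jγ i g) ≡ j

    δ-nonzero : ∀ i → NonzeroDet (δ i)
    δ-nonzero i = D≢0 ∘ ≡.trans (≡.sym (det-δ i))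

    Tᵛ : (Mat → Vec) → Mat → Vec
    Tᵛ c g = ∑[ i ← elements ] act (δ i ι) (c (proj₂ (jγ i g)))

    Tʷ : (Mat → WCarrier V M) → Mat → ZM M × ZM M → Vec
    Tʷ c g uv = ∑[ i ← elements ] act (δ i ι) (c (proj₂ (jγ i g)) (rowMul M uv (δ i ι)))

  module _ {L} (S : CosetSystem L) where

    open CosetSystem S

    jγ-injective : ∀ {g} → InΓ₁ L g → ∀ {i₁ i₂} → proj₁ (jγ i₁ g) ≡ proj₁ (jγ i₂ g) → i₁ ≡ i₂
    jγ-injective {g} g∈Γ {i₁} {i₂} j₁≡j₂ =
      disjoint i₁ i₂ (γ₁ ⊙ γ₂ ι , InΓ₁-⊙ γ₁∈Γ (InΓ₁-ι γ₂∈Γ) ,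
                      ⊙-cancelʳ g (SL2⇒NonzeroDet g (sl2 g∈Γ)) δ₁g≡γ₁γ₂ιδ₂g)
      where
      open ≡.≡-Reasoning
      γ₁ γ₂ : Mat
      γ₁ = proj₂ (jγ i₁ g)
      γ₂ = proj₂ (jγ i₂ g)
      γ₁∈Γ : InΓ₁ L γ₁
      γ₁∈Γ = proj₁ (jγ-ok i₁ g g∈Γ)
      γ₂∈Γ : InΓ₁ L γ₂
      γ₂∈Γ = proj₁ (jγ-ok i₂ g g∈Γ)
      δ₁g≡γ₁γ₂ιδ₂g : δ i₁ ⊙ g ≡ γ₁ ⊙ γ₂ ι ⊙ δ i₂ ⊙ g
      δ₁g≡γ₁γ₂ιδ₂g = begin
        δ i₁ ⊙ g                            ≡⟨ proj₂ (jγ-ok i₁ g g∈Γ) ⟩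
        γ₁ ⊙ δ (proj₁ (jγ i₁ g))            ≡⟨ ≡.cong (λ k → γ₁ ⊙ δ k) j₁≡j₂ ⟩
        γ₁ ⊙ δ (proj₁ (jγ i₂ g))            ≡⟨ ≡.cong (γ₁ ⊙_) (SL2-moveˡ γ₂ (sl2 γ₂∈Γ) (proj₂ (jγ-ok i₂ g g∈Γ))) ⟨
        γ₁ ⊙ (γ₂ ι ⊙ (δ i₂ ⊙ g))            ≡⟨ ⊙-assoc₄ γ₁ (γ₂ ι) (δ i₂) g ⟩
        γ₁ ⊙ γ₂ ι ⊙ δ i₂ ⊙ g                ∎

  sumFin-W : ∀ {n} (fs : Fin n → WCarrier V M) uv →
             sumFin (_+W_ V) (0W V) fs uv ≡ sumFin _∙_ ε (λ i → fs i uv)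
  sumFin-W {zero}  fs uv = ≡.refl
  sumFin-W {suc n} fs uv = ≡.cong (fs Fin.zero uv ∙_) (sumFin-W (fs ∘ Fin.suc) uv)

  module _ {L α} (decomp : CosetDecomp (Γ₁ L) α) where

    open CosetDecomp decomp

    decomp-jγ-ok : ∀ i g → InΓ₁ L g → InΓ₁ L (proj₂ (jγ i g)) × δ i ⊙ g ≡ proj₂ (jγ i g) ⊙ δ (proj₁ (jγ i g))
    decomp-jγ-ok i g g∈Γ = Γ₁⇒InΓ₁ (proj₁ (jγ-ok i g (InΓ₁⇒Γ₁ g∈Γ))) , proj₂ (jγ-ok i g (InΓ₁⇒Γ₁ g∈Γ))

    -- δⱼ g ι lies in Γ α Γ, hence in some coset Γ δᵢ, and then δᵢ g ∈ Γ δⱼ.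
    decomp-jγ-onto : ∀ g → InΓ₁ L g → ∀ j → Σ[ i ∈ Fin k ] proj₁ (jγ i g) ≡ j
    decomp-jγ-onto g g∈Γ j = onto (InCoset⇒Coset (proj₂ (covers (δ j ⊙ g ι) δⱼgι∈ΓαΓ)))
      where
      open ≡.≡-Reasoning
      δⱼgι∈ΓαΓ : InDouble (Γ₁ L) α (δ j ⊙ g ι)
      δⱼgι∈ΓαΓ = Double⇒InDouble (Double-trans (InDouble⇒Double (δ-in j)) (Double-⊙ʳ (δ j) (InΓ₁-ι g∈Γ)))
      onto : ∀ {i} → Coset L (δ i) (δ j ⊙ g ι) → Σ[ i ∈ Fin k ] proj₁ (jγ i g) ≡ j
      onto {i} (η , η∈Γ , δⱼgι≡ηδᵢ) =
        i , ≡.sym (disjoint j (proj₁ (jγ i g)) (Coset⇒InCoset (η ⊙ γ , InΓ₁-⊙ η∈Γ γ∈Γ , δⱼ≡ηγδ)))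
        where
        γ : Mat
        γ = proj₂ (jγ i g)
        γ∈Γ : InΓ₁ L γ
        γ∈Γ = proj₁ (decomp-jγ-ok i g g∈Γ)
        δⱼ≡ηγδ : δ j ≡ η ⊙ γ ⊙ δ (proj₁ (jγ i g))
        δⱼ≡ηγδ = begin
          δ j                          ≡⟨ ⊙-identityʳ (δ j) ⟨
          δ j ⊙ I₂                     ≡⟨ ≡.cong (δ j ⊙_) (ι-inverseˡ g (sl2 g∈Γ)) ⟨
          δ j ⊙ (g ι ⊙ g)              ≡⟨ ⊙-assoc (δ j) (g ι) g ⟨
          δ j ⊙ g ι ⊙ g                ≡⟨ ≡.cong (_⊙ g) δⱼgι≡ηδᵢ ⟩
          η ⊙ δ i ⊙ g                  ≡⟨ ⊙-assoc η (δ i) g ⟩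
          η ⊙ (δ i ⊙ g)                ≡⟨ ≡.cong (η ⊙_) (proj₂ (decomp-jγ-ok i g g∈Γ)) ⟩
          η ⊙ (γ ⊙ δ (proj₁ (jγ i g))) ≡⟨ ⊙-assoc η γ _ ⟨
          η ⊙ γ ⊙ δ (proj₁ (jγ i g))   ∎

    decomp-covers : ∀ {x} → Double L α x → Σ[ i ∈ Fin k ] Coset L (δ i) x
    decomp-covers {x} x∈ΓαΓ = let i , x∈Γδ = covers x (Double⇒InDouble x∈ΓαΓ) in i , InCoset⇒Coset x∈Γδ

    decompSystem : NonzeroDet α → CosetSystem L
    decompSystem α-nonzero = record
      { index = Fin-index k
      ; δ = δ
      ; D = det α
      ; det-δ = λ i → Double-det (InDouble⇒Double (δ-in i))
      ; D≢0 = α-nonzero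
      ; jγ = jγ
      ; jγ-ok = decomp-jγ-ok
      ; disjoint = λ i j → disjoint i j ∘ Coset⇒InCoset
      ; jγ-onto = decomp-jγ-onto
      }

    module _ (α-nonzero : NonzeroDet α) where

      open CosetSystem (decompSystem α-nonzero) using (Tᵛ; Tʷ)

      TαV≡Tᵛ : ∀ c g → TαV V 𝒜 decomp c g ≡ Tᵛ c g
      TαV≡Tᵛ c g = ≡.sym (∑-tabulate {n = k} id (λ i → act (δ i ι) (c (proj₂ (jγ i g)))))

      Sh-TαW≡Tʷ : ∀ c g → Sh V M (TαW V 𝒜 M decomp c) g ≡ Tʷ c g e₀₁
      Sh-TαW≡Tʷ c g = ≡.trans (sumFin-W (λ i → actW V 𝒜 M (δ i ι) (c (proj₂ (jγ i g)))) e₀₁)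
        (≡.sym (∑-tabulate {n = k} id (λ i → act (δ i ι) (c (proj₂ (jγ i g)) (rowMul M e₀₁ (δ i ι))))))

  module _ {L Δⁿ} (hecke : HeckeData (Γ₁ L) Δⁿ) where

    open HeckeData hecke

    private
      module Decomp (k : Fin m) = CosetDecomp (decomp k)

    size : Fin m → ℕ
    size k = Decomp.k k

    Hecke-δ : Pair m size → Mat
    Hecke-δ (k , i) = Decomp.δ k i

    Hecke-jγ : Pair m size → Mat → Pair m size × Mat
    Hecke-jγ (k , i) g = (k , proj₁ (Decomp.jγ k i g)) , proj₂ (Decomp.jγ k i g)

    -- Representatives lying in different double cosets Γ αₖ Γ are in different right cosets.
    Hecke-disjoint : ∀ x y → Coset L (Hecke-δ y) (Hecke-δ x) → x ≡ y
    Hecke-disjoint (k , i) (l , j) coset = same-double-coset (distinct k l (Double⇒InDouble αₖ∈ΓαₗΓ)) coset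
      where
      αₖ∈ΓαₗΓ : Double L (α l) (α k)
      αₖ∈ΓαₗΓ = Double-trans (InDouble⇒Double (Decomp.δ-in l j))
                  (Double-trans (Coset⇒Double coset) (Double-sym (InDouble⇒Double (Decomp.δ-in k i))))
      same-double-coset : k ≡ l → Coset L (Decomp.δ l j) (Decomp.δ k i) → (k , i) ≡ (l , j)
      same-double-coset ≡.refl coset = ≡.cong (k ,_) (Decomp.disjoint k i j (Coset⇒InCoset coset))

    Hecke-δ-in : ∀ p → Double L (α (proj₁ p)) (Hecke-δ p)
    Hecke-δ-in (k , i) = InDouble⇒Double (Decomp.δ-in k i)

    Hecke-covers : ∀ {x} → Δⁿ x → Σ[ p ∈ Pair m size ] Coset L (Hecke-δ p) x
    Hecke-covers {x} x∈Δ =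
      let k , x∈ΓαΓ = covers x x∈Δ
          i , x∈Γδ = decomp-covers (decomp k) (InDouble⇒Double x∈ΓαΓ)
      in (k , i) , x∈Γδ

    heckeSystem : ∀ {D} → (∀ k → det (α k) ≡ D) → D ≢ + 0 → CosetSystem L
    heckeSystem {D} det-α D≢0 = record
      { index = Σ-index m size
      ; δ = Hecke-δ
      ; D = D
      ; det-δ = λ p → ≡.trans (Double-det (Hecke-δ-in p)) (det-α (proj₁ p))
      ; D≢0 = D≢0
      ; jγ = Hecke-jγ
      ; jγ-ok = λ (k , i) → decomp-jγ-ok (decomp k) i
      ; disjoint = Hecke-disjoint
      ; jγ-onto = λ g g∈Γ (k , j) → let i , jγ≡j = decomp-jγ-onto (decomp k) g g∈Γ j
                                   in (k , i) , ≡.cong (k ,_) jγ≡j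
      }

    module _ {D} (det-α : ∀ k → det (α k) ≡ D) (D≢0 : D ≢ + 0) where

      open CosetSystem (heckeSystem det-α D≢0) using (Tᵛ; Tʷ; elements)

      ∑-Hecke : ∀ (f : Pair m size → Vec) →
                ∑ elements f ≈ ∑[ k ← allFin m ] sumFin _∙_ ε (λ i → f (k , i))
      ∑-Hecke f = trans (∑-pairs m size f) (∑-cong (allFin m) (λ k → reflexive (∑-tabulate id (λ i → f (k , i)))))

      TnV≈Tᵛ : ∀ c g → TnV V 𝒜 hecke c g ≈ Tᵛ c g
      TnV≈Tᵛ c g = trans (reflexive (≡.sym (∑-tabulate id (λ k → Tα _∙_ ε act (decomp k) c g))))
                         (sym (∑-Hecke (λ (k , i) → act (Decomp.δ k i ι) (c (proj₂ (Decomp.jγ k i g))))))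

      Sh-TnW≈Tʷ : ∀ c g → Sh V M (TnW V 𝒜 M hecke c) g ≈ Tʷ c g e₀₁
      Sh-TnW≈Tʷ c g = begin
        Sh V M (TnW V 𝒜 M hecke c) g
          ≡⟨ sumFin-W (λ k → TαW V 𝒜 M (decomp k) c g) e₀₁ ⟩
        sumFin _∙_ ε (λ k → TαW V 𝒜 M (decomp k) c g e₀₁)
          ≡⟨ ∑-tabulate id (λ k → TαW V 𝒜 M (decomp k) c g e₀₁) ⟨
        ∑[ k ← allFin m ] TαW V 𝒜 M (decomp k) c g e₀₁
          ≈⟨ ∑-cong (allFin m) (λ k → reflexive
               (sumFin-W (λ i → actW V 𝒜 M (Decomp.δ k i ι) (c (proj₂ (Decomp.jγ k i g)))) e₀₁)) ⟩
        ∑[ k ← allFin m ] sumFin _∙_ ε (λ i → summand (k , i))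
          ≈⟨ ∑-Hecke summand ⟨
        Tʷ c g e₀₁
          ∎
        where
        open import Relation.Binary.Reasoning.Setoid setoid
        summand : Pair m size → Vec
        summand (k , i) = act (Decomp.δ k i ι) (c (proj₂ (Decomp.jγ k i g)) (rowMul M e₀₁ (Decomp.δ k i ι)))

module Comparison {r ℓr v ℓv} {R : Ring r ℓr} {V : LeftModule R v ℓv} (𝒜 : MatAction V)
                  {N M : ℕ} .{{_ : NonZero N}} .{{_ : NonZero M}} (coprime : Coprime N M) where

  import Data.Nat as ℕ
  open import Defs using (Mat; _⊙_; _ι; NonzeroDet; Γ₁; rowMul; Generates; WCarrier; IsWCocycle; Sh; Cohomologous)
  open Matrix
  open CongruenceSubgroup
  open Reduction M
  open Transitivity using (generates?; Γ₁-transitive)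
  open CosetSystems 𝒜 M
  open Action 𝒜
  open import Algebra.Bundles using (AbelianGroup)
  open import Data.Integer using (+_)
  open import Data.Product using (Σ-syntax; _×_; _,_; proj₁; proj₂)
  open import Data.Sum using (_⊎_; inj₁; inj₂; map₂)
  open import Function using (_∘_)
  open import Relation.Nullary using (¬_; yes; no)
  open import Relation.Binary.PropositionalEquality as ≡ using (_≡_)

  open LeftModule V using (+ᴹ-abelianGroup)
  open AbelianGroup +ᴹ-abelianGroup renaming (Carrier to Vec)
  open import Algebra.Properties.AbelianGroup +ᴹ-abelianGroup using (⁻¹-involutive)
  open FiniteSum +ᴹ-abelianGroup
  open MatAction 𝒜

  InΓ₁⇒e₀₁-fixed : ∀ {g} → InΓ₁ (N ℕ.* M) g → rowMul M e₀₁ g ≡ e₀₁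
  InΓ₁⇒e₀₁-fixed {g} g∈Γ′ = bottomRow⇒e₀₁-fixed (FirstColumn.c≋0 (UpperTriangular.column upperᴹ)) (UpperTriangular.d≋ upperᴹ)
    where
    upperᴹ : UpperTriangular M (+ 1) (+ 1) g
    upperᴹ = UpperTriangular-weakenʳ {N} (upper g∈Γ′)

  record Compatible (S : CosetSystem N) (S′ : CosetSystem (N ℕ.* M)) : Set where
    private
      module S = CosetSystem S
      module S′ = CosetSystem S′
    field
      lift    : ∀ i′ → Σ[ i ∈ S.Carrier ] Coset N (S.δ i) (S′.δ i′)
      column  : ∀ i′ → FirstColumn M (+ 1) (S′.δ i′)
      descend : ∀ i {σ} → InΓ₁ N σ → FirstColumn M (+ 1) (σ ⊙ S.δ i) →
                Σ[ i′ ∈ S′.Carrier ] Coset (N ℕ.* M) (S′.δ i′) (σ ⊙ S.δ i)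

  module _ {S : CosetSystem N} {S′ : CosetSystem (N ℕ.* M)} (compatible : Compatible S S′) where

    private
      module S = CosetSystem S
      module S′ = CosetSystem S′
    open Compatible compatible

    φ : S′.Carrier → S.Carrier
    φ i′ = proj₁ (lift i′)

    τ : S′.Carrier → Mat
    τ i′ = proj₁ (proj₂ (lift i′))

    τ∈Γ : ∀ i′ → InΓ₁ N (τ i′)
    τ∈Γ i′ = proj₁ (proj₂ (proj₂ (lift i′)))

    δ′≡τδ : ∀ i′ → S′.δ i′ ≡ τ i′ ⊙ S.δ (φ i′)
    δ′≡τδ i′ = proj₂ (proj₂ (proj₂ (lift i′)))

    δ′ι⊙τ≡δι : ∀ i′ → S′.δ i′ ι ⊙ τ i′ ≡ S.δ (φ i′) ι
    δ′ι⊙τ≡δι i′ = begin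
      S′.δ i′ ι ⊙ τ i′                     ≡⟨ ≡.cong (λ x → x ι ⊙ τ i′) (δ′≡τδ i′) ⟩
      (τ i′ ⊙ S.δ (φ i′)) ι ⊙ τ i′         ≡⟨ ≡.cong (_⊙ τ i′) (ι-anti-⊙ (τ i′) (S.δ (φ i′))) ⟩
      S.δ (φ i′) ι ⊙ τ i′ ι ⊙ τ i′         ≡⟨ ι-cancelʳ (S.δ (φ i′) ι) (τ i′) (sl2 (τ∈Γ i′)) ⟩
      S.δ (φ i′) ι                         ∎
      where open ≡.≡-Reasoning

    e₀₁δι≡e₀₁τ : ∀ i′ → rowMul M e₀₁ (S.δ (φ i′) ι) ≡ rowMul M e₀₁ (τ i′)
    e₀₁δι≡e₀₁τ i′ = begin
      rowMul M e₀₁ (S.δ (φ i′) ι)                ≡⟨ ≡.cong (rowMul M e₀₁) (δ′ι⊙τ≡δι i′) ⟨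
      rowMul M e₀₁ (S′.δ i′ ι ⊙ τ i′)            ≡⟨ rowMul-⊙ e₀₁ (S′.δ i′ ι) (τ i′) ⟨
      rowMul M (rowMul M e₀₁ (S′.δ i′ ι)) (τ i′) ≡⟨ ≡.cong (λ uv → rowMul M uv (τ i′)) (FirstColumn⇒e₀₁-fixed (column i′)) ⟩
      rowMul M e₀₁ (τ i′)                        ∎
      where open ≡.≡-Reasoning

    -- If φ x ≡ φ y then δ′ₓ = σ δ′ᵧ with σ ∈ Γ₁(N), and σ ≡ (1 * ; 0 *) mod M because δ′ₓ and δ′ᵧ are.
    φ-injective : ∀ {x y} → φ x ≡ φ y → x ≡ y
    φ-injective {x} {y} φx≡φy = S′.disjoint x y (σ , σ∈Γ′ , δ′x≡σδ′y)
      where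
      open ≡.≡-Reasoning
      σ : Mat
      σ = τ x ⊙ τ y ι
      δ′x≡σδ′y : S′.δ x ≡ σ ⊙ S′.δ y
      δ′x≡σδ′y = begin
        S′.δ x                       ≡⟨ δ′≡τδ x ⟩
        τ x ⊙ S.δ (φ x)              ≡⟨ ≡.cong (λ i → τ x ⊙ S.δ i) φx≡φy ⟩
        τ x ⊙ S.δ (φ y)              ≡⟨ ≡.cong (τ x ⊙_) (SL2-moveˡ (τ y) (sl2 (τ∈Γ y)) (δ′≡τδ y)) ⟨
        τ x ⊙ (τ y ι ⊙ S′.δ y)       ≡⟨ ⊙-assoc (τ x) (τ y ι) (S′.δ y) ⟨
        σ ⊙ S′.δ y                   ∎
      σ∈Γ′ : InΓ₁ (N ℕ.* M) σ
      σ∈Γ′ = InΓ₁-crt-column coprime (InΓ₁-⊙ (τ∈Γ x) (InΓ₁-ι (τ∈Γ y)))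
               (FirstColumn-cancelʳ (column y) (≡.subst (FirstColumn M (+ 1)) δ′x≡σδ′y (column x)))

    -- When (0,1) δᵢ ι generates, transitivity of Γ₁(N) on generating pairs produces σ with
    -- σ δᵢ ≡ (1 * ; 0 *) mod M, and σ δᵢ lies in a coset of S′ over Γ δᵢ.
    φ-covers : ∀ i → (Σ[ i′ ∈ S′.Carrier ] φ i′ ≡ i) ⊎ ¬ Generates M (rowMul M e₀₁ (S.δ i ι))
    φ-covers i with generates? M (rowMul M e₀₁ (S.δ i ι))
    ... | no ¬generates = inj₂ ¬generates
    ... | yes generates = inj₁ (from-transit (Γ₁-transitive coprime (rowMul M e₀₁ (S.δ i ι)) generates))
      where
      from-transit : Σ[ σ ∈ Mat ] InΓ₁ N σ × rowMul M e₀₁ σ ≡ rowMul M e₀₁ (S.δ i ι) →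
                     Σ[ i′ ∈ S′.Carrier ] φ i′ ≡ i
      from-transit (σ , σ∈Γ , e₀₁σ≡e₀₁δι) =
        from-descent (descend i σ∈Γ (FirstColumn-transport (sl2 σ∈Γ) e₀₁σ≡e₀₁δι))
        where
        from-descent : Σ[ i′ ∈ S′.Carrier ] Coset (N ℕ.* M) (S′.δ i′) (σ ⊙ S.δ i) → Σ[ i′ ∈ S′.Carrier ] φ i′ ≡ i
        from-descent (i′ , γ , γ∈Γ′ , σδ≡γδ′) =
          i′ , ≡.sym (S.disjoint i (φ i′) (σ ι ⊙ γ ⊙ τ i′ , InΓ₁-⊙ (InΓ₁-⊙ (InΓ₁-ι σ∈Γ) (InΓ₁-weakenˡ γ∈Γ′)) (τ∈Γ i′) , δ≡Xδ))
          where
          open ≡.≡-Reasoning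
          δ≡Xδ : S.δ i ≡ σ ι ⊙ γ ⊙ τ i′ ⊙ S.δ (φ i′)
          δ≡Xδ = begin
            S.δ i                                ≡⟨ SL2-moveˡ σ (sl2 σ∈Γ) ≡.refl ⟨
            σ ι ⊙ (σ ⊙ S.δ i)                    ≡⟨ ≡.cong (σ ι ⊙_) σδ≡γδ′ ⟩
            σ ι ⊙ (γ ⊙ S′.δ i′)                  ≡⟨ ≡.cong (λ x → σ ι ⊙ (γ ⊙ x)) (δ′≡τδ i′) ⟩
            σ ι ⊙ (γ ⊙ (τ i′ ⊙ S.δ (φ i′)))      ≡⟨ ⊙-assoc₄ (σ ι) γ (τ i′) (S.δ (φ i′)) ⟩
            σ ι ⊙ γ ⊙ τ i′ ⊙ S.δ (φ i′)          ∎

    module _ (c : Mat → WCarrier V M) (c-cocycle : IsWCocycle V 𝒜 M (Γ₁ N) c) where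

      open WCocycle c c-cocycle

      w : S′.Carrier → Vec
      w i′ = act (S′.δ i′ ι) (c (τ i′) e₀₁)

      u : S′.Carrier → Vec
      u i′ = act (S′.δ i′ ι) (act (τ i′) (c (τ i′ ι) (rowMul M e₀₁ (τ i′))))

      δ′ι-nonzero : ∀ i′ → NonzeroDet (S′.δ i′ ι)
      δ′ι-nonzero i′ = NonzeroDet-ι (S′.δ i′) (S′.δ-nonzero i′)

      u≈w⁻¹ : ∀ i′ → u i′ ≈ w i′ ⁻¹
      u≈w⁻¹ i′ = begin
        u i′                                                        ≈⟨ act-cong (S′.δ i′ ι) (δ′ι-nonzero i′) (act-c-ι (τ∈Γ i′) e₀₁) ⟩
        act (S′.δ i′ ι) (c (τ i′) e₀₁ ⁻¹ ∙ c I₂ e₀₁)                ≈⟨ act-+ (S′.δ i′ ι) (δ′ι-nonzero i′) _ _ ⟩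
        act (S′.δ i′ ι) (c (τ i′) e₀₁ ⁻¹) ∙ act (S′.δ i′ ι) (c I₂ e₀₁) ≈⟨ ∙-cong (act-⁻¹ (S′.δ i′ ι) (δ′ι-nonzero i′) _)
                                                                                      (act-c-I₂ (S′.δ i′ ι) (δ′ι-nonzero i′) e₀₁) ⟩
        w i′ ⁻¹ ∙ ε                                                 ≈⟨ identityʳ _ ⟩
        w i′ ⁻¹                                                     ∎
        where open import Relation.Binary.Reasoning.Setoid setoid

      lhs : Mat → S′.Carrier → Vec
      lhs g i′ = act (S′.δ i′ ι) (c (proj₂ (S′.jγ i′ g)) e₀₁)

      rhs : Mat → S.Carrier → Vec
      rhs g i = act (S.δ i ι) (c (proj₂ (S.jγ i g)) (rowMul M e₀₁ (S.δ i ι)))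

      module Step {g} (g∈Γ′ : InΓ₁ (N ℕ.* M) g) (i′ : S′.Carrier) where

        j′ : S′.Carrier
        j′ = proj₁ (S′.jγ i′ g)

        γ′ : Mat
        γ′ = proj₂ (S′.jγ i′ g)

        i : S.Carrier
        i = φ i′

        j : S.Carrier
        j = proj₁ (S.jγ i g)

        γ : Mat
        γ = proj₂ (S.jγ i g)

        γ′∈Γ′ : InΓ₁ (N ℕ.* M) γ′
        γ′∈Γ′ = proj₁ (S′.jγ-ok i′ g g∈Γ′)

        γ∈Γ : InΓ₁ N γ
        γ∈Γ = proj₁ (S.jγ-ok i g (InΓ₁-weakenˡ g∈Γ′))

        τγδ≡γ′τδ : τ i′ ⊙ γ ⊙ S.δ j ≡ γ′ ⊙ τ j′ ⊙ S.δ (φ j′)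
        τγδ≡γ′τδ = begin
          τ i′ ⊙ γ ⊙ S.δ j             ≡⟨ ⊙-assoc (τ i′) γ (S.δ j) ⟩
          τ i′ ⊙ (γ ⊙ S.δ j)           ≡⟨ ≡.cong (τ i′ ⊙_) (proj₂ (S.jγ-ok i g (InΓ₁-weakenˡ g∈Γ′))) ⟨
          τ i′ ⊙ (S.δ i ⊙ g)           ≡⟨ ⊙-assoc (τ i′) (S.δ i) g ⟨
          τ i′ ⊙ S.δ i ⊙ g             ≡⟨ ≡.cong (_⊙ g) (δ′≡τδ i′) ⟨
          S′.δ i′ ⊙ g                  ≡⟨ proj₂ (S′.jγ-ok i′ g g∈Γ′) ⟩
          γ′ ⊙ S′.δ j′                 ≡⟨ ≡.cong (γ′ ⊙_) (δ′≡τδ j′) ⟩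
          γ′ ⊙ (τ j′ ⊙ S.δ (φ j′))     ≡⟨ ⊙-assoc γ′ (τ j′) (S.δ (φ j′)) ⟨
          γ′ ⊙ τ j′ ⊙ S.δ (φ j′)       ∎
          where open ≡.≡-Reasoning

        γ′τ∈Γ : InΓ₁ N (γ′ ⊙ τ j′)
        γ′τ∈Γ = InΓ₁-⊙ (InΓ₁-weakenˡ γ′∈Γ′) (τ∈Γ j′)

        φj′≡j : φ j′ ≡ j
        φj′≡j = S.disjoint (φ j′) j
          ( (γ′ ⊙ τ j′) ι ⊙ (τ i′ ⊙ γ)
          , InΓ₁-⊙ (InΓ₁-ι γ′τ∈Γ) (InΓ₁-⊙ (τ∈Γ i′) γ∈Γ)
          , ≡.trans (≡.sym (SL2-moveˡ (γ′ ⊙ τ j′) (sl2 γ′τ∈Γ) τγδ≡γ′τδ))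
                    (≡.sym (⊙-assoc ((γ′ ⊙ τ j′) ι) (τ i′ ⊙ γ) (S.δ j))) )

        τγ≡γ′τ : τ i′ ⊙ γ ≡ γ′ ⊙ τ j′
        τγ≡γ′τ = ⊙-cancelʳ (S.δ j) (S.δ-nonzero j)
                   (≡.trans τγδ≡γ′τδ (≡.cong (λ k → γ′ ⊙ τ j′ ⊙ S.δ k) φj′≡j))

        γ′≡τγτι : γ′ ≡ τ i′ ⊙ (γ ⊙ τ j′ ι)
        γ′≡τγτι = ≡.trans (≡.sym (SL2-moveʳ (τ j′) (sl2 (τ∈Γ j′)) τγ≡γ′τ)) (⊙-assoc (τ i′) γ (τ j′ ι))

        e₀₁τγ≡e₀₁τ : rowMul M (rowMul M e₀₁ (τ i′)) γ ≡ rowMul M e₀₁ (τ j′)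
        e₀₁τγ≡e₀₁τ = begin
          rowMul M (rowMul M e₀₁ (τ i′)) γ    ≡⟨ rowMul-⊙ e₀₁ (τ i′) γ ⟩
          rowMul M e₀₁ (τ i′ ⊙ γ)             ≡⟨ ≡.cong (rowMul M e₀₁) τγ≡γ′τ ⟩
          rowMul M e₀₁ (γ′ ⊙ τ j′)            ≡⟨ rowMul-⊙ e₀₁ γ′ (τ j′) ⟨
          rowMul M (rowMul M e₀₁ γ′) (τ j′)   ≡⟨ ≡.cong (λ uv → rowMul M uv (τ j′)) (InΓ₁⇒e₀₁-fixed γ′∈Γ′) ⟩
          rowMul M e₀₁ (τ j′)                 ∎
          where open ≡.≡-Reasoning

        δι⊙γ≡g⊙δ′ι⊙τ : S.δ i ι ⊙ γ ≡ g ⊙ (S′.δ j′ ι ⊙ τ j′)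
        δι⊙γ≡g⊙δ′ι⊙τ = begin
          S.δ i ι ⊙ γ                 ≡⟨ ι-swap (S.δ i) (S.δ j) g γ (≡.trans (S.det-δ i) (≡.sym (S.det-δ j)))
                                                (S.δ-nonzero j) (proj₂ (S.jγ-ok i g (InΓ₁-weakenˡ g∈Γ′))) ⟩
          g ⊙ S.δ j ι                 ≡⟨ ≡.cong (λ k → g ⊙ S.δ k ι) φj′≡j ⟨
          g ⊙ S.δ (φ j′) ι            ≡⟨ ≡.cong (g ⊙_) (δ′ι⊙τ≡δι j′) ⟨
          g ⊙ (S′.δ j′ ι ⊙ τ j′)      ∎
          where open ≡.≡-Reasoning

        private
          g-nonzero : NonzeroDet g
          g-nonzero = SL2⇒NonzeroDet g (sl2 g∈Γ′)
          δι-nonzero : NonzeroDet (S.δ i ι)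
          δι-nonzero = NonzeroDet-ι (S.δ i) (S.δ-nonzero i)
          γ-nonzero : NonzeroDet γ
          γ-nonzero = SL2⇒NonzeroDet γ (sl2 γ∈Γ)
          τ-nonzero : ∀ k′ → NonzeroDet (τ k′)
          τ-nonzero k′ = SL2⇒NonzeroDet (τ k′) (sl2 (τ∈Γ k′))

        lhs-expand : lhs g i′ ≈ w i′ ∙ act (S.δ i ι) (c (γ ⊙ τ j′ ι) (rowMul M e₀₁ (τ i′)))
        lhs-expand = begin
          act (S′.δ i′ ι) (c γ′ e₀₁)
            ≡⟨ ≡.cong (λ h → act (S′.δ i′ ι) (c h e₀₁)) γ′≡τγτι ⟩
          act (S′.δ i′ ι) (c (τ i′ ⊙ (γ ⊙ τ j′ ι)) e₀₁)
            ≈⟨ act-cong (S′.δ i′ ι) (δ′ι-nonzero i′) (expand (τ∈Γ i′) (InΓ₁-⊙ γ∈Γ (InΓ₁-ι (τ∈Γ j′))) e₀₁) ⟩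
          act (S′.δ i′ ι) (c (τ i′) e₀₁ ∙ act (τ i′) (c (γ ⊙ τ j′ ι) (rowMul M e₀₁ (τ i′))))
            ≈⟨ act-+ (S′.δ i′ ι) (δ′ι-nonzero i′) _ _ ⟩
          w i′ ∙ act (S′.δ i′ ι) (act (τ i′) (c (γ ⊙ τ j′ ι) (rowMul M e₀₁ (τ i′))))
            ≈⟨ ∙-congˡ (act-∘ (S′.δ i′ ι) (τ i′) (δ′ι-nonzero i′) (τ-nonzero i′) _) ⟨
          w i′ ∙ act (S′.δ i′ ι ⊙ τ i′) (c (γ ⊙ τ j′ ι) (rowMul M e₀₁ (τ i′)))
            ≈⟨ ∙-congˡ (act-≡ (δ′ι⊙τ≡δι i′) _) ⟩
          w i′ ∙ act (S.δ i ι) (c (γ ⊙ τ j′ ι) (rowMul M e₀₁ (τ i′)))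
            ∎
          where open import Relation.Binary.Reasoning.Setoid setoid

        rhs-expand : act (S.δ i ι) (c (γ ⊙ τ j′ ι) (rowMul M e₀₁ (τ i′))) ≈ rhs g i ∙ act g (u j′)
        rhs-expand = begin
          act (S.δ i ι) (c (γ ⊙ τ j′ ι) (rowMul M e₀₁ (τ i′)))
            ≈⟨ act-cong (S.δ i ι) δι-nonzero (expand γ∈Γ (InΓ₁-ι (τ∈Γ j′)) _) ⟩
          act (S.δ i ι) (c γ (rowMul M e₀₁ (τ i′)) ∙ act γ (c (τ j′ ι) (rowMul M (rowMul M e₀₁ (τ i′)) γ)))
            ≈⟨ act-+ (S.δ i ι) δι-nonzero _ _ ⟩
          act (S.δ i ι) (c γ (rowMul M e₀₁ (τ i′))) ∙ act (S.δ i ι) (act γ (c (τ j′ ι) (rowMul M (rowMul M e₀₁ (τ i′)) γ)))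
            ≡⟨ ≡.cong₂ (λ x y → act (S.δ i ι) (c γ x) ∙ act (S.δ i ι) (act γ (c (τ j′ ι) y))) (≡.sym (e₀₁δι≡e₀₁τ i′)) e₀₁τγ≡e₀₁τ ⟩
          rhs g i ∙ act (S.δ i ι) (act γ (c (τ j′ ι) (rowMul M e₀₁ (τ j′))))
            ≈⟨ ∙-congˡ (act-∘ (S.δ i ι) γ δι-nonzero γ-nonzero _) ⟨
          rhs g i ∙ act (S.δ i ι ⊙ γ) (c (τ j′ ι) (rowMul M e₀₁ (τ j′)))
            ≈⟨ ∙-congˡ (act-≡ δι⊙γ≡g⊙δ′ι⊙τ _) ⟩
          rhs g i ∙ act (g ⊙ (S′.δ j′ ι ⊙ τ j′)) (c (τ j′ ι) (rowMul M e₀₁ (τ j′)))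
            ≈⟨ ∙-congˡ (act-∘ g _ g-nonzero (NonzeroDet-⊙ (S′.δ j′ ι) (τ j′) (δ′ι-nonzero j′) (τ-nonzero j′)) _) ⟩
          rhs g i ∙ act g (act (S′.δ j′ ι ⊙ τ j′) (c (τ j′ ι) (rowMul M e₀₁ (τ j′))))
            ≈⟨ ∙-congˡ (act-cong g g-nonzero (act-∘ (S′.δ j′ ι) (τ j′) (δ′ι-nonzero j′) (τ-nonzero j′) _)) ⟩
          rhs g i ∙ act g (u j′)
            ∎
          where open import Relation.Binary.Reasoning.Setoid setoid

        lhs≈w∙rhs∙u : lhs g i′ ≈ w i′ ∙ (rhs g i ∙ act g (u j′))
        lhs≈w∙rhs∙u = trans lhs-expand (∙-congˡ rhs-expand)

      rhs-vanishes : ∀ {g} → InΓ₁ (N ℕ.* M) g → ∀ i → ¬ Generates M (rowMul M e₀₁ (S.δ i ι)) → rhs g i ≈ ε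
      rhs-vanishes {g} g∈Γ′ i ¬generates =
        trans (act-cong (S.δ i ι) δι-nonzero (vanishes (proj₁ (S.jγ-ok i g (InΓ₁-weakenˡ g∈Γ′))) _ ¬generates))
              (act-ε (S.δ i ι) δι-nonzero)
        where
        δι-nonzero : NonzeroDet (S.δ i ι)
        δι-nonzero = NonzeroDet-ι (S.δ i) (S.δ-nonzero i)

      -- Summing lhs ≈ w ∙ (rhs ∘ φ ∙ g.(u ∘ j′)) over S′: φ reindexes the rhs-terms onto S (the missed ones
      -- vanish), i′ ↦ j′ permutes S′, and u ≈ w⁻¹, so what remains is the coboundary of (∑ w)⁻¹.
      Tᵛ-Sh∼Tʷ : Cohomologous V 𝒜 (Γ₁ (N ℕ.* M)) (S′.Tᵛ (Sh V M c)) (λ g → S.Tʷ c g e₀₁)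
      Tᵛ-Sh∼Tʷ = W ⁻¹ , λ g → coboundary g ∘ Γ₁⇒InΓ₁
        where
        W : Vec
        W = ∑ S′.elements w
        coboundary : ∀ g → InΓ₁ (N ℕ.* M) g → S′.Tᵛ (λ h → c h e₀₁) g ≈ S.Tʷ c g e₀₁ ∙ (act g (W ⁻¹) ∙ W ⁻¹ ⁻¹)
        coboundary g g∈Γ′ = begin
          ∑ S′.elements (lhs g)                                           ≈⟨ ∑-cong S′.elements (Step.lhs≈w∙rhs∙u g∈Γ′) ⟩
          ∑[ i′ ← S′.elements ] (w i′ ∙ (rhs g (φ i′) ∙ act g (u (j′ i′)))) ≈⟨ ∑-distrib S′.elements w _ ⟩
          W ∙ ∑[ i′ ← S′.elements ] (rhs g (φ i′) ∙ act g (u (j′ i′)))     ≈⟨ ∙-congˡ (∑-distrib S′.elements _ _) ⟩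
          W ∙ (∑[ i′ ← S′.elements ] rhs g (φ i′) ∙ ∑[ i′ ← S′.elements ] act g (u (j′ i′)))
                                                                          ≈⟨ ∙-congˡ (∙-cong (sym reindex-rhs) permute-u) ⟩
          W ∙ (S.Tʷ c g e₀₁ ∙ act g (W ⁻¹))                               ≈⟨ rearrange W (S.Tʷ c g e₀₁) (act g (W ⁻¹)) ⟩
          S.Tʷ c g e₀₁ ∙ (act g (W ⁻¹) ∙ W ⁻¹ ⁻¹)                         ∎
          where
          open import Relation.Binary.Reasoning.Setoid setoid
          g-nonzero : NonzeroDet g
          g-nonzero = SL2⇒NonzeroDet g (sl2 g∈Γ′)
          j′ : S′.Carrier → S′.Carrier
          j′ i′ = proj₁ (S′.jγ i′ g)
          reindex-rhs : ∑ S.elements (rhs g) ≈ ∑[ i′ ← S′.elements ] rhs g (φ i′)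
          reindex-rhs = ∑-reindex S.index S′.index φ φ-injective (rhs g)
            (λ i → map₂ (rhs-vanishes g∈Γ′ i) (φ-covers i))
          permute-u : ∑[ i′ ← S′.elements ] act g (u (j′ i′)) ≈ act g (W ⁻¹)
          permute-u = begin
            ∑[ i′ ← S′.elements ] act g (u (j′ i′))   ≈⟨ act-∑ g g-nonzero S′.elements (u ∘ j′) ⟨
            act g (∑[ i′ ← S′.elements ] u (j′ i′))   ≈⟨ act-cong g g-nonzero (∑-reindex S′.index S′.index j′
                                                           (jγ-injective S′ g∈Γ′) u (inj₁ ∘ S′.jγ-onto g g∈Γ′)) ⟨
            act g (∑ S′.elements u)                   ≈⟨ act-cong g g-nonzero (∑-cong S′.elements u≈w⁻¹) ⟩
            act g (∑[ i′ ← S′.elements ] (w i′ ⁻¹))   ≈⟨ act-cong g g-nonzero (∑-⁻¹ S′.elements w) ⟨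
            act g (W ⁻¹)                              ∎
          rearrange : ∀ x y z → x ∙ (y ∙ z) ≈ y ∙ (z ∙ x ⁻¹ ⁻¹)
          rearrange x y z = trans (solve 3 (λ x y z → x ⊕ (y ⊕ z) ⊜ y ⊕ (z ⊕ x)) refl x y z)
                                  (∙-congˡ (∙-congˡ (sym (⁻¹-involutive x))))
            where open import Algebra.Solver.CommutativeMonoid commutativeMonoid using (solve; _⊕_; _⊜_)

module Instances {r ℓr v ℓv} {R : Ring r ℓr} {V : LeftModule R v ℓv} (𝒜 : MatAction V)
                 {N M : ℕ} .{{_ : NonZero N}} .{{_ : NonZero M}} (coprime : Coprime N M) where

  import Data.Nat as ℕ
  open import Defs
    using ( Mat; _⊙_; _ι; det; SL2; Γ₁; Δ; HeckeData; CosetDecomp; DiamondMat; DiamondMatNM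
          ; _≡_[mod_]; WCarrier; IsWCocycle; Sh; Cohomologous; TnV; TnW; TαV; TαW )
  open Congruence
  open Matrix
  open CongruenceSubgroup
  open CosetSystems 𝒜 M
  open Comparison 𝒜 coprime
  open Action 𝒜 using (Cohomologous-cong)
  open import Algebra.Bundles using (AbelianGroup)
  open import Data.Integer using (ℤ; +_; _*_)
  open import Data.Fin using (Fin)
  open import Data.Product using (Σ-syntax; _,_; proj₁)
  open import Relation.Binary.PropositionalEquality as ≡ using (_≡_; _≢_)

  open LeftModule V using (+ᴹ-abelianGroup)
  open AbelianGroup +ᴹ-abelianGroup using (sym; reflexive)

  module _ {n : ℕ} (H : HeckeData (Γ₁ N) (Δ N n)) (H′ : HeckeData (Γ₁ (N ℕ.* M)) (Δ (N ℕ.* M) n))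
           (n≢0 : + n ≢ + 0) where

    Hecke-InΔ : ∀ {L} (hecke : HeckeData (Γ₁ L) (Δ L n)) p → InΔ L n (Hecke-δ hecke p)
    Hecke-InΔ hecke p = Double-InΔ (Δ⇒InΔ {g = HeckeData.α hecke (proj₁ p)} (HeckeData.α-in hecke (proj₁ p))) (Hecke-δ-in hecke p)

    Hecke-det : ∀ {L} (hecke : HeckeData (Γ₁ L) (Δ L n)) k → det (HeckeData.α hecke k) ≡ + n
    Hecke-det hecke k = proj₁ (HeckeData.α-in hecke k)

    Tn-compatible : Compatible (heckeSystem H (Hecke-det H) n≢0) (heckeSystem H′ (Hecke-det H′) n≢0)
    Tn-compatible = record
      { lift = λ p′ → Hecke-covers H (InΔ⇒Δ (InΔ-weakenˡ (Hecke-InΔ H′ p′)))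
      ; column = λ p′ → FirstColumn-weakenʳ {N} (InΔ.column (Hecke-InΔ H′ p′))
      ; descend = λ p σ∈Γ column →
          Hecke-covers H′ (InΔ⇒Δ (InΔ-crt coprime (InΓ₁-⊙-InΔ σ∈Γ (Hecke-InΔ H p)) column))
      }

    Tn-Sh∼Sh-Tn : (c : Mat → WCarrier V M) → IsWCocycle V 𝒜 M (Γ₁ N) c →
                  Cohomologous V 𝒜 (Γ₁ (N ℕ.* M)) (TnV V 𝒜 H′ (Sh V M c)) (Sh V M (TnW V 𝒜 M H c))
    Tn-Sh∼Sh-Tn c c-cocycle = Cohomologous-cong
      (TnV≈Tᵛ H′ (Hecke-det H′) n≢0 (Sh V M c)) (Sh-TnW≈Tʷ H (Hecke-det H) n≢0 c)
      (Tᵛ-Sh∼Tʷ Tn-compatible c c-cocycle)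

  record Diamond (dd : ℕ) (α : Mat) : Set where
    constructor diamond
    field
      sl2 : SL2 α
      d⁻¹ : ℤ
      d⁻¹d≋1 : d⁻¹ * + dd ≋ + 1 [mod N ]
      upperᴺ : UpperTriangular N d⁻¹ (+ dd) α

  DiamondMat⇒Diamond : ∀ {dd α} → DiamondMat N dd α → Diamond dd α
  DiamondMat⇒Diamond (α-sl2 , d⁻¹ , d⁻¹d≡1 , a≡d⁻¹ , _ , c≡0 , d≡dd) =
    diamond α-sl2 d⁻¹ (≡mod⇒≋ d⁻¹d≡1) (upperTriangular (firstColumn (≡mod⇒≋ a≡d⁻¹) (≡mod⇒≋ c≡0)) (≡mod⇒≋ d≡dd))

  DiamondMatNM⇒UpperTriangular : ∀ {dd β} → DiamondMatNM N M dd β → UpperTriangular M (+ 1) (+ 1) β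
  DiamondMatNM⇒UpperTriangular (_ , a≡1 , _ , c≡0 , d≡1) =
    upperTriangular (firstColumn (≡mod⇒≋ a≡1) (≡mod⇒≋ c≡0)) (≡mod⇒≋ d≡1)

  module _ {dd α β} (α-diamond : DiamondMat N dd α) (D : CosetDecomp (Γ₁ N) α)
           (β-diamond : DiamondMatNM N M dd β) (D′ : CosetDecomp (Γ₁ (N ℕ.* M)) β) where

    private
      α◇ : Diamond dd α
      α◇ = DiamondMat⇒Diamond {α = α} α-diamond
      β◇ : Diamond dd β
      β◇ = DiamondMat⇒Diamond {α = β} (proj₁ β-diamond)
      α-sl2 : SL2 α
      α-sl2 = Diamond.sl2 α◇
      β-sl2 : SL2 β
      β-sl2 = Diamond.sl2 β◇
      β-upperᴹ : UpperTriangular M (+ 1) (+ 1) β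
      β-upperᴹ = DiamondMatNM⇒UpperTriangular {β = β} β-diamond

    βαι∈Γ : InΓ₁ N (β ⊙ α ι)
    βαι∈Γ = inΓ₁ (SL2-⊙ β (α ι) β-sl2 (SL2-ι α α-sl2))
      (UpperTriangular-⊙ι (Diamond.upperᴺ β◇) (Diamond.upperᴺ α◇) (Diamond.d⁻¹d≋1 β◇) (Diamond.d⁻¹d≋1 α◇))

    β∈ΓαΓ : Double N α β
    β∈ΓαΓ = β ⊙ α ι , I₂ , βαι∈Γ , InΓ₁-I₂ , ≡.sym (≡.trans (⊙-identityʳ (β ⊙ α ι ⊙ α)) (ι-cancelʳ β α α-sl2))

    -- σ δᵢ ≡ diag(d⁻¹, d) mod N and ≡ (1 * ; 0 *) mod M, so σ δᵢ β ι ∈ Γ₁(NM).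
    diamond-descend : ∀ i {σ} → InΓ₁ N σ → FirstColumn M (+ 1) (σ ⊙ CosetDecomp.δ D i) →
                      Σ[ i′ ∈ Fin (CosetDecomp.k D′) ] Coset (N ℕ.* M) (CosetDecomp.δ D′ i′) (σ ⊙ CosetDecomp.δ D i)
    diamond-descend i {σ} σ∈Γ columnᴹ = decomp-covers D′ (Coset⇒Double (x ⊙ β ι , xβι∈Γ′ , ≡.sym (ι-cancelʳ x β β-sl2)))
      where
      x : Mat
      x = σ ⊙ CosetDecomp.δ D i
      x∈ΓαΓ : Double N α x
      x∈ΓαΓ = Double-trans (InDouble⇒Double (CosetDecomp.δ-in D i)) (Coset⇒Double (σ , σ∈Γ , ≡.refl))
      x-sl2 : SL2 x
      x-sl2 = ≡.trans (Double-det x∈ΓαΓ) α-sl2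
      xβι∈Γ′ : InΓ₁ (N ℕ.* M) (x ⊙ β ι)
      xβι∈Γ′ = InΓ₁-crt-column coprime
        (inΓ₁ (SL2-⊙ x (β ι) x-sl2 (SL2-ι β β-sl2))
              (UpperTriangular-⊙ι (Double-UpperTriangular x∈ΓαΓ (Diamond.upperᴺ α◇)) (Diamond.upperᴺ β◇)
                                  (Diamond.d⁻¹d≋1 α◇) (Diamond.d⁻¹d≋1 β◇)))
        (FirstColumn-⊙ columnᴹ (UpperTriangular.column (UpperTriangular-ι β-upperᴹ)))

    diamond-compatible : Compatible (decompSystem D (SL2⇒NonzeroDet α α-sl2)) (decompSystem D′ (SL2⇒NonzeroDet β β-sl2))
    diamond-compatible = record
      { lift = λ i′ → decomp-covers D (Double-trans β∈ΓαΓ (Double-weakenˡ (InDouble⇒Double (CosetDecomp.δ-in D′ i′))))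
      ; column = λ i′ → UpperTriangular.column
          (Double-UpperTriangular (Double-weakenʳ {N} (InDouble⇒Double (CosetDecomp.δ-in D′ i′)))
                                  β-upperᴹ)
      ; descend = diamond-descend
      }

    diamond-Sh∼Sh-diamond : (c : Mat → WCarrier V M) → IsWCocycle V 𝒜 M (Γ₁ N) c →
                            Cohomologous V 𝒜 (Γ₁ (N ℕ.* M)) (TαV V 𝒜 D′ (Sh V M c)) (Sh V M (TαW V 𝒜 M D c))
    diamond-Sh∼Sh-diamond c c-cocycle = Cohomologous-cong
      (λ g → reflexive (TαV≡Tᵛ D′ (SL2⇒NonzeroDet β β-sl2) (Sh V M c) g))
      (λ g → reflexive (Sh-TαW≡Tʷ D (SL2⇒NonzeroDet α α-sl2) c g))
      (Tᵛ-Sh∼Tʷ diamond-compatible c c-cocycle)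

open import Defs
open import Data.Nat using (_≤_; _*_)
open import Data.Product using (_×_; _,_)
import Data.Nat.Properties as ℕ
open import Data.Integer using (+_)
import Data.Integer.Properties as ℤ
open import Function using (_∘_)
open import Relation.Binary.PropositionalEquality using (_≢_)

proposition3p4 : ∀ {r ℓr m ℓm} (N M : ℕ) .{{_ : NonZero N}} .{{_ : NonZero M}} →
    Coprime N M →
    (R : Ring r ℓr) (V : LeftModule R m ℓm) (A : MatAction V) →
    (n dd : ℕ) → 1 ≤ n → 1 ≤ dd → Coprime dd N →
    (c : Mat → WCarrier V M) → IsWCocycle V A M (Γ₁ N) c →
    ((H : HeckeData (Γ₁ N) (Δ N n)) (H' : HeckeData (Γ₁ (N * M)) (Δ (N * M) n)) →
      Cohomologous V A (Γ₁ (N * M))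
        (TnV V A H' (Sh V M c))
        (Sh V M (TnW V A M H c)))
    ×
    ((α : Mat) → DiamondMat N dd α → (D : CosetDecomp (Γ₁ N) α) →
     (β : Mat) → DiamondMatNM N M dd β → (D' : CosetDecomp (Γ₁ (N * M)) β) →
      Cohomologous V A (Γ₁ (N * M))
        (TαV V A D' (Sh V M c))
        (Sh V M (TαW V A M D c)))
proposition3p4 N M coprime R V A n dd 1≤n _ _ c c-cocycle =
  (λ H H′ → Tn-Sh∼Sh-Tn H H′ n≢0 c c-cocycle) ,
  (λ α α-diamond D β β-diamond D′ → diamond-Sh∼Sh-diamond α-diamond D β-diamond D′ c c-cocycle)
  where
  open Instances A coprime
  n≢0 : + n ≢ + 0
  n≢0 = ℕ.m<n⇒n≢0 1≤n ∘ ℤ.+-injective
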